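{- Let $V,V'$ be finite sets and let $\mathcal{A},\mathcal{A}'\subseteq\Pi(V)\times\mathbb{N}$ be such that $\mathcal{A}'$ ac-represents $\mathcal{A}$. Then: (1) for every $\mathcal{B}\subseteq\Pi(V)\times\mathbb{N}$, $\mathcal{A}'\cup\mathcal{B}$ ac-represents $\mathcal{A}\cup\mathcal{B}$; (2) $\mathsf{rmc}(\mathcal{A}')$ ac-represents $\mathsf{rmc}(\mathcal{A})$; (3) for every $X\subseteq V$, $\mathsf{proj}(\mathcal{A}',X)$ ac-represents $\mathsf{proj}(\mathcal{A},X)$; (4) for every $\mathcal{B}\subseteq\Pi(V')\times\mathbb{N}$, $\mathsf{acjoin}(\mathcal{A}',\mathcal{B})$ ac-represents $\mathsf{acjoin}(\mathcal{A},\mathcal{B})$ and $\mathsf{acjoin}(\mathcal{B},\mathcal{A}')$ ac-represents $\mathsf{acjoin}(\mathcal{B},\mathcal{A})$.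
   Context: $\Pi(V)$ is the set of partitions of $V$ (blocks are non-empty, pairwise disjoint, union $V$). For $p,q\in\Pi(V)$, $p\sqcup q$ is the join in the refinement lattice (finest partition coarser than both), and $\#p$ is the number of blocks. $\textsf{acyclic}(p,q)$ holds iff $|V|+\#(p\sqcup q)-(\#p+\#q)=0$. For $X\subseteq V$, $p_{\downarrow X}=\{B\cap X\mid B\in p\}\setminus\{\emptyset\}\in\Pi(X)$; for $Y\supseteq V$, $p_{\uparrow Y}=p\cup\{\{y\}\mid y\in Y\setminus V\}\in\Pi(Y)$. For $\mathcal{A}\subseteq\Pi(V)\times\mathbb{N}$ and $q\in\Pi(V)$, $\mathbf{ac\textrm{ - }opt}(\mathcal{A},q)=\max\{w\mid (p,w)\in\mathcal{A},\ p\sqcup q=\{V\},\ \textsf{acyclic}(p,q)\}$ (with $\max\emptyset=-\infty$); $\mathcal{A}'$ ac-represents $\mathcal{A}$ if $\mathbf{ac\textrm{ - }opt}(\mathcal{A},q)=\mathbf{ac\textrm{ - }opt}(\mathcal{A}',q)$ for all $q\in\Pi(V)$. Operators: $\mathsf{rmc}(\mathcal{A})=\{(p,w)\in\mathcal{A}\mid \forall (p,w')\in\mathcal{A},\ w'\le w\}$; for $X\subseteq V$, $\mathsf{proj}(\mathcal{A},X)=\{(p_{\downarrow(V\setminus X)},w)\mid (p,w)\in\mathcal{A},\ \forall B\in p,\ B\setminus X\neq\emptyset\}\subseteq\Pi(V\setminus X)\times\mathbb{N}$; for $\mathcal{A}\subseteq\Pi(V)\times\mathbb{N}$, $\mathcal{B}\subseteq\Pi(V')\times\mathbb{N}$,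 $\mathsf{acjoin}(\mathcal{A},\mathcal{B})=\{(p_{\uparrow(V\cup V')}\sqcup q_{\uparrow(V\cup V')},w_1+w_2)\mid (p,w_1)\in\mathcal{A},(q,w_2)\in\mathcal{B},\ \textsf{acyclic}(p_{\uparrow(V\cup V')},q_{\uparrow(V\cup V')})\}\subseteq\Pi(V\cup V')\times\mathbb{N}$. -}

module Defs where

open import Data.Bool using (Bool; true; false; _∧_; _∨_; not; if_then_else_)
open import Data.Nat using (ℕ; zero; suc; _+_; _≡ᵇ_; _<ᵇ_; _≤ᵇ_; _⊔_)
open import Data.Fin using (Fin; toℕ)
open import Data.Fin.Subset using (Subset; _∪_; _─_)
open import Data.Vec using (lookup)
open import Data.List using (List; []; _∷_; length; filterᵇ; map; foldr; concatMap; allFin)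
open import Data.Bool.ListAction using (any; all)
open import Data.Maybe using (Maybe; just; nothing)
open import Data.Product using (_×_; _,_; proj₁; proj₂)
open import Relation.Binary.PropositionalEquality using (_≡_)

-- Ambient universe Fin n; the finite ground sets V are subsets of Fin n.
-- A partition of V is encoded by its "same block" relation, as a Bool-valued
-- relation on Fin n which is an equivalence relation on V and false outside V.
-- (This encoding is canonical: equal partitions have equal relations.)

Rel : ℕ → Set
Rel n = Fin n → Fin n → Bool

_!_ : ∀ {n} → Subset n → Fin n → Bool
V ! i = lookup V i

record IsPartition {n : ℕ} (V : Subset n) (p : Rel n) : Set where
  field
    support : ∀ i j → p i j ≡ true → (V ! i ≡ true) × (V ! j ≡ true)
    refl′   : ∀ i → V ! i ≡ true → p i i ≡ true
    sym′    : ∀ i j → p i j ≡ true → p j i ≡ true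
    trans′  : ∀ i j k → p i j ≡ true → p j k ≡ true → p i k ≡ true

_⇔ᵇ_ : Bool → Bool → Bool
true  ⇔ᵇ b = b
false ⇔ᵇ b = not b

allPairs : ∀ {n} → (Fin n → Fin n → Bool) → Bool
allPairs {n} f = all (λ i → all (λ j → f i j) (allFin n)) (allFin n)

eqRel : ∀ {n} → Rel n → Rel n → Bool
eqRel p q = allPairs (λ i j → p i j ⇔ᵇ q i j)

card : ∀ {n} → Subset n → ℕ
card {n} V = length (filterᵇ (λ i → V ! i) (allFin n))

-- #p : number of blocks, counted by their least elements
isLeast : ∀ {n} → Rel n → Fin n → Bool
isLeast {n} p i = p i i ∧ not (any (λ j → (toℕ j <ᵇ toℕ i) ∧ p j i) (allFin n))

nblocks : ∀ {n} → Rel n → ℕ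
nblocks {n} p = length (filterᵇ (isLeast p) (allFin n))

-- join p ⊔ q in the refinement lattice: the equivalence relation generated by
-- p ∪ q, i.e. its transitive closure (computed by n rounds of squaring).
closeStep : ∀ {n} → Rel n → Rel n
closeStep {n} r i j = r i j ∨ any (λ k → r i k ∧ r k j) (allFin n)

iter : ∀ {n} → ℕ → Rel n → Rel n
iter zero    r = r
iter (suc m) r = iter m (closeStep r)

join : ∀ {n} → Rel n → Rel n → Rel n
join {n} p q = iter n (λ i j → p i j ∨ q i j)

isTop : ∀ {n} → Subset n → Rel n → Bool
isTop V r = allPairs (λ i j → r i j ⇔ᵇ (V ! i ∧ V ! j))

acyclicᵇ : ∀ {n} → Subset n → Rel n → Rel n → Bool
acyclicᵇ V p q = (card V + nblocks (join p q)) ≡ᵇ (nblocks p + nblocks q)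

Family : ℕ → Set
Family n = List (Rel n × ℕ)

-- max with  max ∅ = -∞  (nothing = -∞)
maxM : ℕ → Maybe ℕ → Maybe ℕ
maxM w nothing  = just w
maxM w (just v) = just (w ⊔ v)

acOpt : ∀ {n} → Subset n → Family n → Rel n → Maybe ℕ
acOpt V A q =
  foldr maxM nothing
    (map proj₂ (filterᵇ (λ pw → isTop V (join (proj₁ pw) q) ∧ acyclicᵇ V (proj₁ pw) q) A))

AcRepresents : ∀ {n} → Subset n → Family n → Family n → Set
AcRepresents {n} V A′ A = ∀ (q : Rel n) → IsPartition V q → acOpt V A q ≡ acOpt V A′ q

rmc : ∀ {n} → Family n → Family n
rmc A = filterᵇ (λ pw → all (λ pw′ → not (eqRel (proj₁ pw) (proj₁ pw′)) ∨ (proj₂ pw′ ≤ᵇ proj₂ pw)) A) A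

restrict : ∀ {n} → Subset n → Rel n → Rel n
restrict W p i j = p i j ∧ W ! i ∧ W ! j

blocksLeaveX : ∀ {n} → Subset n → Rel n → Bool
blocksLeaveX {n} X p = all (λ i → not (p i i) ∨ any (λ j → p i j ∧ not (X ! j)) (allFin n)) (allFin n)

proj : ∀ {n} → Subset n → Subset n → Family n → Family n
proj V X A = map (λ pw → restrict (V ─ X) (proj₁ pw) , proj₂ pw) (filterᵇ (λ pw → blocksLeaveX X (proj₁ pw)) A)

_==ᶠ_ : ∀ {n} → Fin n → Fin n → Bool
i ==ᶠ j = toℕ i ≡ᵇ toℕ j

lift : ∀ {n} → Subset n → Subset n → Rel n → Rel n
lift V Y p i j = p i j ∨ ((i ==ᶠ j) ∧ Y ! i ∧ not (V ! i))

acjoin : ∀ {n} → Subset n → Subset n → Family n → Family n → Family n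
acjoin V V′ A B =
  concatMap (λ pw → concatMap (λ qw →
      let U  = V ∪ V′
          p↑ = lift V U (proj₁ pw)
          q↑ = lift V′ U (proj₁ qw)
      in if acyclicᵇ U p↑ q↑ then (join p↑ q↑ , proj₂ pw + proj₂ qw) ∷ [] else []) B) A

AllPartitions : ∀ {n} → Subset n → Family n → Set
AllPartitions V A = ∀ {pw} → pw ∈L A → IsPartition V (proj₁ pw)
  where open import Data.List.Membership.Propositional renaming (_∈_ to _∈L_)

-- Say that 𝒜′ outweighs 𝒜 (w.r.t. q) when every feasible entry (p , w) of 𝒜 (p ⊔ q = {V} and
-- acyclic(p , q)) is matched by a feasible entry of 𝒜′ of weight ≥ w; two families ac-represent each
-- other iff each outweighs the other for every q.  Each operation preserves this order because the
-- feasibility of an entry of op(𝒜) against q is the feasibility of the underlying entry of 𝒜 against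
-- a partition built from q: q↑V for proj, and for acjoin with an entry b of ℬ, the trace on V of
-- b↑ ⊔ q (together with a condition on b and q alone).  Two facts make this work.  Restricting a
-- partition to a set meeting all its blocks keeps the number of blocks, which transports both {V} and
-- acyclicity between V and a larger ground set.  The block count is subadditive,
-- #a + #b ≤ |U| + #(a ⊔ b), so acyclic(a , b) ∧ acyclic(a ⊔ b , c) and acyclic(b , c) ∧ acyclic(a , b ⊔ c)
-- both say that #a + #b + #c = 2|U| + #(a ⊔ b ⊔ c).

module Submission where

open import Defs
open import Data.Bool using (Bool; true; false; _∧_; _∨_; not; if_then_else_; T)
open import Data.Bool.Properties using (T-≡; ⇔→≡; ¬-not; ∧-zeroʳ; ∧-identityʳ; ∨-identityʳ)
open import Data.Vec using (_∷_)
open import Data.Vec.Properties using (lookup-zipWith)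
open import Data.Nat using (ℕ; zero; suc; _+_; _≤_; _<_; z≤n; s≤s; _⊔_; _<ᵇ_; _≡ᵇ_; _≤ᵇ_)
open import Data.Nat.Properties hiding (_≟_)
open import Data.Nat.Tactic.RingSolver using (solve-∀)
open import Data.Fin using (Fin; zero; suc; toℕ)
open import Data.Fin.Properties using (toℕ-injective; _≟_)
open import Data.Fin.Subset using (Subset; _⊆_; _∪_; _─_)
open import Data.Fin.Subset.Properties using (∪-comm)
open import Data.List using (List; []; _∷_; _++_; length; map; filterᵇ; foldr; allFin)
open import Data.List.Properties using (length-filter; length-tabulate)
open import Data.List.Membership.Propositional using (_∈_; find; lose)
open import Data.List.Membership.Propositional.Properties
  using (∈-filter⁺; ∈-filter⁻; ∈-map⁺; ∈-map⁻; ∈-++⁺ˡ; ∈-++⁺ʳ; ∈-++⁻; ∈-∃++; ∈-allFin; ∈-concatMap⁺; ∈-concatMap⁻)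
open import Data.List.Relation.Unary.Any using (here; there)
open import Data.List.Relation.Unary.Any.Properties using (any⁺; any⁻)
open import Data.List.Relation.Unary.All as All using ()
open import Data.List.Relation.Unary.All.Properties using (all⁺; all⁻)
open import Data.List.Relation.Unary.AllPairs using (_∷_; [])
open import Data.List.Relation.Unary.Unique.Propositional using (Unique)
open import Data.List.Relation.Unary.Unique.Propositional.Properties using (allFin⁺; filter⁺)
open import Data.Bool.ListAction using (any; all)
open import Data.Maybe using (Maybe; just; nothing; fromMaybe)
import Data.Maybe as Maybe
open import Data.Product using (∃; ∃₂; _×_; _,_; proj₁; proj₂)
open import Data.Sum using (_⊎_; inj₁; inj₂)
open import Data.Empty using (⊥; ⊥-elim)
open import Function using (_∘_; _⇔_; mk⇔; Equivalence)
import Function.Properties.Equivalence as ⇔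
open import Relation.Nullary using (yes; no)
open import Relation.Nullary.Decidable using (T?)
open import Relation.Binary.PropositionalEquality
  using (_≡_; _≢_; refl; sym; trans; cong; cong₂; subst; module ≡-Reasoning)

private
  variable
    A : Set

∧-true⁺ : ∀ {a b} → a ≡ true → b ≡ true → a ∧ b ≡ true
∧-true⁺ refl refl = refl

∧-true⁻ : ∀ a {b} → a ∧ b ≡ true → a ≡ true × b ≡ true
∧-true⁻ true refl = refl , refl

∨-true⁺ˡ : ∀ {a} b → a ≡ true → a ∨ b ≡ true
∨-true⁺ˡ b refl = refl

∨-true⁺ʳ : ∀ a {b} → b ≡ true → a ∨ b ≡ true
∨-true⁺ʳ true  _ = refl
∨-true⁺ʳ false e = e

∨-true⁻ : ∀ a {b} → a ∨ b ≡ true → a ≡ true ⊎ b ≡ true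
∨-true⁻ true  _ = inj₁ refl
∨-true⁻ false e = inj₂ e

bool-ext : ∀ {a b} → (a ≡ true → b ≡ true) → (b ≡ true → a ≡ true) → a ≡ b
bool-ext f g = ⇔→≡ (mk⇔ f g)

true-or-false : ∀ a → a ≡ true ⊎ a ≡ false
true-or-false true  = inj₁ refl
true-or-false false = inj₂ refl

true≢false : true ≢ false
true≢false ()

T⇒true : ∀ {a} → T a → a ≡ true
T⇒true = Equivalence.to T-≡

true⇒T : ∀ {a} → a ≡ true → T a
true⇒T = Equivalence.from T-≡

⇔ᵇ-true⁻ : ∀ a {b} → (a ⇔ᵇ b) ≡ true → a ≡ b
⇔ᵇ-true⁻ true  {true}  _ = refl
⇔ᵇ-true⁻ false {false} _ = refl

⇔ᵇ-true⁺ : ∀ a {b} → a ≡ b → (a ⇔ᵇ b) ≡ true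
⇔ᵇ-true⁺ true  refl = refl
⇔ᵇ-true⁺ false refl = refl

not-true⁻ : ∀ {a} → not a ≡ true → a ≡ false
not-true⁻ {false} _ = refl

∈-filterᵇ⁺ : ∀ (f : A → Bool) {x} xs → x ∈ xs → f x ≡ true → x ∈ filterᵇ f xs
∈-filterᵇ⁺ f xs x∈xs fx = ∈-filter⁺ (T? ∘ f) x∈xs (true⇒T fx)

∈-filterᵇ⁻ : ∀ (f : A → Bool) {x} xs → x ∈ filterᵇ f xs → x ∈ xs × f x ≡ true
∈-filterᵇ⁻ f xs x∈ with ∈-filter⁻ (T? ∘ f) {xs = xs} x∈
... | x∈xs , fx = x∈xs , T⇒true fx

any-true⁺ : ∀ (f : A → Bool) {x} xs → x ∈ xs → f x ≡ true → any f xs ≡ true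
any-true⁺ f xs x∈xs fx = T⇒true (any⁺ f (lose x∈xs (true⇒T fx)))

any-true⁻ : ∀ (f : A → Bool) xs → any f xs ≡ true → ∃ λ x → x ∈ xs × f x ≡ true
any-true⁻ f xs e with find (any⁻ f xs (true⇒T e))
... | x , x∈xs , fx = x , x∈xs , T⇒true fx

all-true⁺ : ∀ (f : A → Bool) xs → (∀ {x} → x ∈ xs → f x ≡ true) → all f xs ≡ true
all-true⁺ f xs h = T⇒true (all⁻ f (All.tabulate (true⇒T ∘ h)))

all-true⁻ : ∀ (f : A → Bool) xs → all f xs ≡ true → ∀ {x} → x ∈ xs → f x ≡ true
all-true⁻ f xs e x∈xs = T⇒true (All.lookup (all⁺ f xs (true⇒T e)) x∈xs)

all-false⁻ : ∀ (f : A → Bool) xs → all f xs ≡ false → ∃ λ x → x ∈ xs × f x ≡ false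
all-false⁻ f (y ∷ xs) e with f y in fy
... | false = y , here refl , fy
... | true  = let x , x∈xs , fx = all-false⁻ f xs e in x , there x∈xs , fx

anyFin-true⁺ : ∀ {n} (f : Fin n → Bool) i → f i ≡ true → any f (allFin n) ≡ true
anyFin-true⁺ {n} f i = any-true⁺ f (allFin n) (∈-allFin i)

anyFin-true⁻ : ∀ {n} (f : Fin n → Bool) → any f (allFin n) ≡ true → ∃ λ i → f i ≡ true
anyFin-true⁻ {n} f e = let i , _ , fi = any-true⁻ f (allFin n) e in i , fi

allFin-true⁺ : ∀ {n} (f : Fin n → Bool) → (∀ i → f i ≡ true) → all f (allFin n) ≡ true
allFin-true⁺ {n} f h = all-true⁺ f (allFin n) (λ {i} _ → h i)

allFin-true⁻ : ∀ {n} (f : Fin n → Bool) → all f (allFin n) ≡ true → ∀ i → f i ≡ true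
allFin-true⁻ {n} f e i = all-true⁻ f (allFin n) e (∈-allFin i)

allFin-false⁻ : ∀ {n} (f : Fin n → Bool) → all f (allFin n) ≡ false → ∃ λ i → f i ≡ false
allFin-false⁻ {n} f e = let i , _ , fi = all-false⁻ f (allFin n) e in i , fi

-- Counting and maxima in lists

countᵇ : (A → Bool) → List A → ℕ
countᵇ f xs = length (filterᵇ f xs)

countᵇ-cong : ∀ (f g : A → Bool) xs → (∀ x → f x ≡ g x) → countᵇ f xs ≡ countᵇ g xs
countᵇ-cong f g []       h = refl
countᵇ-cong f g (x ∷ xs) h with f x | g x | h x
... | true  | true  | _ = cong suc (countᵇ-cong f g xs h)
... | false | false | _ = countᵇ-cong f g xs h

countᵇ-mono : ∀ (f g : A → Bool) xs → (∀ {x} → x ∈ xs → f x ≡ true → g x ≡ true) →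
              countᵇ f xs ≤ countᵇ g xs
countᵇ-mono f g []       h = z≤n
countᵇ-mono f g (x ∷ xs) h with f x in fx | g x in gx
... | true  | true  = s≤s (countᵇ-mono f g xs (h ∘ there))
... | false | true  = m≤n⇒m≤1+n (countᵇ-mono f g xs (h ∘ there))
... | false | false = countᵇ-mono f g xs (h ∘ there)
... | true  | false with () ← trans (sym (h (here refl) fx)) gx

countᵇ-mono-< : ∀ (f g : A → Bool) {x} xs → (∀ {y} → y ∈ xs → f y ≡ true → g y ≡ true) →
                x ∈ xs → g x ≡ true → f x ≡ false → countᵇ f xs < countᵇ g xs
countᵇ-mono-< f g (y ∷ xs) h (here refl) gx fx rewrite gx | fx = s≤s (countᵇ-mono f g xs (h ∘ there))
countᵇ-mono-< f g (y ∷ xs) h (there x∈xs) gx fx with f y in fy | g y in gy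
... | true  | true  = s≤s (countᵇ-mono-< f g xs (h ∘ there) x∈xs gx fx)
... | false | true  = m≤n⇒m≤1+n (countᵇ-mono-< f g xs (h ∘ there) x∈xs gx fx)
... | false | false = countᵇ-mono-< f g xs (h ∘ there) x∈xs gx fx
... | true  | false with () ← trans (sym (h (here refl) fy)) gy

countᵇ-≤-length : ∀ (f : A → Bool) xs → countᵇ f xs ≤ length xs
countᵇ-≤-length f = length-filter (T? ∘ f)

countᵇ-∨ : ∀ (f g : A → Bool) xs → (∀ x → f x ≡ true → g x ≡ false) →
           countᵇ (λ x → f x ∨ g x) xs ≡ countᵇ f xs + countᵇ g xs
countᵇ-∨ f g []       h = refl
countᵇ-∨ f g (x ∷ xs) h with f x in fx | g x in gx
... | true  | false = cong suc (countᵇ-∨ f g xs h)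
... | false | true  = trans (cong suc (countᵇ-∨ f g xs h)) (sym (+-suc _ _))
... | false | false = countᵇ-∨ f g xs h
... | true  | true with () ← trans (sym (h x fx)) gx

countᵇ-false : ∀ (f : A → Bool) xs → (∀ x → f x ≡ false) → countᵇ f xs ≡ 0
countᵇ-false f []       h = refl
countᵇ-false f (x ∷ xs) h rewrite h x = countᵇ-false f xs h

injection⇒length-≤ : ∀ {B : Set} (φ : A → B) xs ys → Unique xs →
                     (∀ {x y} → x ∈ xs → y ∈ xs → φ x ≡ φ y → x ≡ y) →
                     (∀ {x} → x ∈ xs → φ x ∈ ys) → length xs ≤ length ys
injection⇒length-≤ φ []       ys _          _   _    = z≤n
injection⇒length-≤ φ (x ∷ xs) ys (x∉ ∷ !xs) inj into with ∈-∃++ (into (here refl))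
... | as , bs , refl =
  subst (suc (length xs) ≤_) (sym (length-insert as bs))
        (s≤s (injection⇒length-≤ φ xs (as ++ bs) !xs (λ p q → inj (there p) (there q)) into′))
  where
  length-insert : ∀ as bs → length (as ++ φ x ∷ bs) ≡ suc (length (as ++ bs))
  length-insert []       bs = refl
  length-insert (_ ∷ as) bs = cong suc (length-insert as bs)
  into′ : ∀ {y} → y ∈ xs → φ y ∈ as ++ bs
  into′ y∈xs with ∈-++⁻ as (into (there y∈xs))
  ... | inj₁ p           = ∈-++⁺ˡ p
  ... | inj₂ (here φy≡φx) = ⊥-elim (All.lookup x∉ y∈xs (sym (inj (there y∈xs) (here refl) φy≡φx)))
  ... | inj₂ (there p)    = ∈-++⁺ʳ as p

countᵇ-injection : ∀ (f g : A → Bool) (φ : A → A) xs → Unique xs →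
  (∀ {x} → x ∈ xs → f x ≡ true → φ x ∈ xs × g (φ x) ≡ true) →
  (∀ {x y} → x ∈ xs → y ∈ xs → f x ≡ true → f y ≡ true → φ x ≡ φ y → x ≡ y) →
  countᵇ f xs ≤ countᵇ g xs
countᵇ-injection f g φ xs !xs into inj =
  injection⇒length-≤ φ (filterᵇ f xs) (filterᵇ g xs) (filter⁺ (T? ∘ f) !xs)
    (λ p q → let p∈ , fp = ∈-filterᵇ⁻ f xs p ; q∈ , fq = ∈-filterᵇ⁻ f xs q in inj p∈ q∈ fp fq)
    (λ p → let p∈ , fp = ∈-filterᵇ⁻ f xs p ; φp∈ , gφp = into p∈ fp in ∈-filterᵇ⁺ g xs φp∈ gφp)

countᵇ-≤-suc : ∀ (f g : A → Bool) xs → Unique xs →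
  (∀ {x y} → x ∈ xs → y ∈ xs → f x ≡ true → g x ≡ false → f y ≡ true → g y ≡ false → x ≡ y) →
  countᵇ f xs ≤ suc (countᵇ g xs)
countᵇ-≤-suc f g []       _          _ = z≤n
countᵇ-≤-suc f g (x ∷ xs) (x∉ ∷ !xs) h with f x in fx | g x in gx
... | true  | true  = s≤s (countᵇ-≤-suc f g xs !xs (λ p q → h (there p) (there q)))
... | false | true  = m≤n⇒m≤1+n (countᵇ-≤-suc f g xs !xs (λ p q → h (there p) (there q)))
... | false | false = countᵇ-≤-suc f g xs !xs (λ p q → h (there p) (there q))
... | true  | false = s≤s (countᵇ-mono f g xs no-other-exception)
  where
  no-other-exception : ∀ {y} → y ∈ xs → f y ≡ true → g y ≡ true
  no-other-exception {y} y∈xs fy = ¬-not λ gy →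
    All.lookup x∉ y∈xs (h (here refl) (there y∈xs) fx gx fy gy)

maximum : List ℕ → Maybe ℕ
maximum = foldr maxM nothing

data MaximumSpec (xs : List ℕ) : Maybe ℕ → Set where
  empty    : xs ≡ [] → MaximumSpec xs nothing
  attained : ∀ {m} → m ∈ xs → (∀ {x} → x ∈ xs → x ≤ m) → MaximumSpec xs (just m)

maximum-spec : ∀ xs → MaximumSpec xs (maximum xs)
maximum-spec []       = empty refl
maximum-spec (x ∷ xs) with maximum xs | maximum-spec xs
... | nothing | empty refl      = attained (here refl) λ { (here refl) → ≤-refl }
... | just m  | attained m∈ ub = attained x⊔m∈ bound
  where
  x⊔m∈ : x ⊔ m ∈ x ∷ xs
  x⊔m∈ with ⊔-sel x m
  ... | inj₁ x⊔m≡x = subst (_∈ x ∷ xs) (sym x⊔m≡x) (here refl)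
  ... | inj₂ x⊔m≡m = subst (_∈ x ∷ xs) (sym x⊔m≡m) (there m∈)
  bound : ∀ {y} → y ∈ x ∷ xs → y ≤ x ⊔ m
  bound (here refl) = m≤m⊔n x m
  bound (there y∈)  = ≤-trans (ub y∈) (m≤n⊔m x m)

_≼_ : List ℕ → List ℕ → Set
xs ≼ ys = ∀ {x} → x ∈ xs → ∃ λ y → y ∈ ys × x ≤ y

maximum-cong : ∀ xs ys → xs ≼ ys → ys ≼ xs → maximum xs ≡ maximum ys
maximum-cong xs ys xs≼ys ys≼xs with maximum xs | maximum-spec xs | maximum ys | maximum-spec ys
... | nothing | empty _ | nothing | empty _ = refl
... | nothing | empty refl | just _ | attained m∈ _ with () ← proj₁ (proj₂ (ys≼xs m∈))
... | just _ | attained m∈ _ | nothing | empty refl with () ← proj₁ (proj₂ (xs≼ys m∈))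
... | just m | attained m∈ ub | just m′ | attained m′∈ ub′ = cong just (≤-antisym
  (let _ , y∈ , m≤y = xs≼ys m∈ in ≤-trans m≤y (ub′ y∈))
  (let _ , x∈ , m′≤x = ys≼xs m′∈ in ≤-trans m′≤x (ub x∈)))

maximum-≡⇒≼ : ∀ xs ys → maximum xs ≡ maximum ys → xs ≼ ys
maximum-≡⇒≼ xs ys eq x∈ with maximum xs | maximum-spec xs | maximum ys | maximum-spec ys
... | nothing | empty refl | _ | _ with () ← x∈
... | just _ | attained _ _ | nothing | _ with () ← eq
... | just m | attained _ ub | just m′ | attained m′∈ _ with refl ← eq = m′ , m′∈ , ub x∈

-- Joins as transitive closures

module _ {n : ℕ} where

  _⊆ᴿ_ : Rel n → Rel n → Set
  p ⊆ᴿ q = ∀ i j → p i j ≡ true → q i j ≡ true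

  _≐_ : Rel n → Rel n → Set
  p ≐ q = ∀ i j → p i j ≡ q i j

  ⊆ᴿ-trans : ∀ {p q r} → p ⊆ᴿ q → q ⊆ᴿ r → p ⊆ᴿ r
  ⊆ᴿ-trans p⊆q q⊆r i j = q⊆r i j ∘ p⊆q i j

  ⊆ᴿ-antisym : ∀ {p q} → p ⊆ᴿ q → q ⊆ᴿ p → p ≐ q
  ⊆ᴿ-antisym p⊆q q⊆p i j = bool-ext (p⊆q i j) (q⊆p i j)

  Transitive : (Fin n → Fin n → Set) → Set
  Transitive E = ∀ i j k → E i j → E j k → E i k

  TransitiveRel : Rel n → Set
  TransitiveRel r = Transitive (λ i j → r i j ≡ true)

  iter-inflationary : ∀ m (r : Rel n) → r ⊆ᴿ iter m r
  iter-inflationary zero    r i j e = e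
  iter-inflationary (suc m) r i j e = iter-inflationary m (closeStep r) i j (∨-true⁺ˡ _ e)

  iter-least : ∀ m (r : Rel n) (E : Fin n → Fin n → Set) → Transitive E →
               (∀ i j → r i j ≡ true → E i j) → ∀ i j → iter m r i j ≡ true → E i j
  iter-least zero    r E E-trans r⊆E = r⊆E
  iter-least (suc m) r E E-trans r⊆E = iter-least m (closeStep r) E E-trans step⊆E
    where
    step⊆E : ∀ i j → closeStep r i j ≡ true → E i j
    step⊆E i j e with ∨-true⁻ (r i j) e
    ... | inj₁ rij = r⊆E i j rij
    ... | inj₂ ∃k  = let k , rikj = anyFin-true⁻ _ ∃k ; rik , rkj = ∧-true⁻ (r i k) rikj in
                     E-trans i k j (r⊆E i k rik) (r⊆E k j rkj)

  iter-suc : ∀ m (r : Rel n) i j → iter (suc m) r i j ≡ closeStep (iter m r) i j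
  iter-suc zero    r i j = refl
  iter-suc (suc m) r i j = iter-suc m (closeStep r) i j

module Reachability {n : ℕ} (r : Rel n) where

  -- reach l i j: j is reachable from i by a walk of 1 to l + 1 steps of r
  reach : ℕ → Rel n
  reach zero    = r
  reach (suc l) i j = reach l i j ∨ any (λ k → reach l i k ∧ r k j) (allFin n)

  reach-suc⁺ : ∀ l i j → reach l i j ≡ true → reach (suc l) i j ≡ true
  reach-suc⁺ l i j = ∨-true⁺ˡ _

  reach-snoc : ∀ l i k j → reach l i k ≡ true → r k j ≡ true → reach (suc l) i j ≡ true
  reach-snoc l i k j rik rkj = ∨-true⁺ʳ (reach l i j) (anyFin-true⁺ _ k (∧-true⁺ rik rkj))

  r⊆reach : ∀ l → r ⊆ᴿ reach l
  r⊆reach zero    i j e = e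
  r⊆reach (suc l) i j e = reach-suc⁺ l i j (r⊆reach l i j e)

  reach⊆iter : ∀ l → reach l ⊆ᴿ iter l r
  reach⊆iter zero    i j e = e
  reach⊆iter (suc l) i j e rewrite iter-suc l r i j with ∨-true⁻ (reach l i j) e
  ... | inj₁ rij = ∨-true⁺ˡ _ (reach⊆iter l i j rij)
  ... | inj₂ ∃k  =
    let k , rikj = anyFin-true⁻ _ ∃k ; rik , rkj = ∧-true⁻ (reach l i k) rikj in
    ∨-true⁺ʳ (iter l r i j)
      (anyFin-true⁺ _ k (∧-true⁺ (reach⊆iter l i k rik) (iter-inflationary l r k j rkj)))

  RowStable : ℕ → Fin n → Set
  RowStable l i = ∀ j → reach (suc l) i j ≡ true → reach l i j ≡ true

  rowSize : ℕ → Fin n → ℕ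
  rowSize l i = countᵇ (reach l i) (allFin n)

  rowStable-suc : ∀ l i → RowStable l i → RowStable (suc l) i
  rowStable-suc l i stable j e with ∨-true⁻ (reach (suc l) i j) e
  ... | inj₁ rij = rij
  ... | inj₂ ∃k  = let k , rikj = anyFin-true⁻ _ ∃k ; rik , rkj = ∧-true⁻ (reach (suc l) i k) rikj in
                   reach-snoc l i k j (stable k rik) rkj

  rowStable-or-grows : ∀ l i → RowStable l i ⊎ rowSize l i < rowSize (suc l) i
  rowStable-or-grows l i with all (λ j → not (reach (suc l) i j) ∨ reach l i j) (allFin n) in e
  ... | true  = inj₁ λ j → implies (allFin-true⁻ _ e j)
    where
    implies : ∀ {a b} → not a ∨ b ≡ true → a ≡ true → b ≡ true
    implies {true} b refl = b
  ... | false = let j , e′ = allFin-false⁻ _ e ; r′ij , ¬rij = witness e′ in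
    inj₂ (countᵇ-mono-< (reach l i) (reach (suc l) i) (allFin n)
            (λ {j} _ → reach-suc⁺ l i j) (∈-allFin j) r′ij ¬rij)
    where
    witness : ∀ {a b} → not a ∨ b ≡ false → a ≡ true × b ≡ false
    witness {true} {false} _ = refl , refl

  rowStable-or-large : ∀ l i → RowStable l i ⊎ l < rowSize (suc l) i
  rowStable-or-large zero i with rowStable-or-grows zero i
  ... | inj₁ stable = inj₁ stable
  ... | inj₂ grows  = inj₂ (≤-trans (s≤s z≤n) grows)
  rowStable-or-large (suc l) i with rowStable-or-large l i
  ... | inj₁ stable = inj₁ (rowStable-suc l i stable)
  ... | inj₂ large with rowStable-or-grows (suc l) i
  ...   | inj₁ stable = inj₁ stable
  ...   | inj₂ grows  = inj₂ (≤-trans (s≤s large) grows)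

  -- a row that has not stabilised has grown at every step, but it has at most n entries
  rowStable-n : ∀ i → RowStable n i
  rowStable-n i with rowStable-or-large n i
  ... | inj₁ stable = stable
  ... | inj₂ large  = ⊥-elim (<-irrefl refl (<-≤-trans large row≤n))
    where
    row≤n : rowSize (suc n) i ≤ n
    row≤n = subst (rowSize (suc n) i ≤_) (length-tabulate {n = n} (λ i → i)) (countᵇ-≤-length _ (allFin n))

  reach-n-trans : ∀ l i j k → reach n i j ≡ true → reach l j k ≡ true → reach n i k ≡ true
  reach-n-trans zero    i j k rij rjk = rowStable-n i k (reach-snoc n i j k rij rjk)
  reach-n-trans (suc l) i j k rij rjk with ∨-true⁻ (reach l j k) rjk
  ... | inj₁ r′jk = reach-n-trans l i j k rij r′jk
  ... | inj₂ ∃m   = let m , rjmk = anyFin-true⁻ _ ∃m ; rjm , rmk = ∧-true⁻ (reach l j m) rjmk in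
                    rowStable-n i k (reach-snoc n i m k (reach-n-trans l i j m rij rjm) rmk)

  iter-trans : TransitiveRel (iter n r)
  iter-trans i j k rij rjk = reach⊆iter n i k (reach-n-trans n i j k (iter⊆reach i j rij) (iter⊆reach j k rjk))
    where
    iter⊆reach : iter n r ⊆ᴿ reach n
    iter⊆reach = iter-least n r (λ i j → reach n i j ≡ true)
                   (λ i j k → reach-n-trans n i j k) (r⊆reach n)

module _ {n : ℕ} where

  join-trans : ∀ (p q : Rel n) → TransitiveRel (join p q)
  join-trans p q = Reachability.iter-trans (λ i j → p i j ∨ q i j)

  join-least : ∀ (p q : Rel n) (E : Fin n → Fin n → Set) → Transitive E →
               (∀ i j → p i j ≡ true → E i j) → (∀ i j → q i j ≡ true → E i j) →
               ∀ i j → join p q i j ≡ true → E i j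
  join-least p q E E-trans p⊆E q⊆E = iter-least n _ E E-trans p∨q⊆E
    where
    p∨q⊆E : ∀ i j → p i j ∨ q i j ≡ true → E i j
    p∨q⊆E i j e with ∨-true⁻ (p i j) e
    ... | inj₁ pij = p⊆E i j pij
    ... | inj₂ qij = q⊆E i j qij

  join-lub : ∀ {p q e : Rel n} → TransitiveRel e → p ⊆ᴿ e → q ⊆ᴿ e → join p q ⊆ᴿ e
  join-lub {p} {q} {e} = join-least p q (λ i j → e i j ≡ true)

  join-inl : ∀ (p q : Rel n) → p ⊆ᴿ join p q
  join-inl p q i j e = iter-inflationary n _ i j (∨-true⁺ˡ _ e)

  join-inr : ∀ (p q : Rel n) → q ⊆ᴿ join p q
  join-inr p q i j e = iter-inflationary n _ i j (∨-true⁺ʳ (p i j) e)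

  join-comm : ∀ (p q : Rel n) → join p q ≐ join q p
  join-comm p q = ⊆ᴿ-antisym (join-lub (join-trans q p) (join-inr q p) (join-inl q p))
                             (join-lub (join-trans p q) (join-inr p q) (join-inl p q))

  join-assoc : ∀ (a b c : Rel n) → join (join a b) c ≐ join a (join b c)
  join-assoc a b c = ⊆ᴿ-antisym
    (join-lub (join-trans a _)
      (join-lub (join-trans a _) (join-inl a _) (⊆ᴿ-trans (join-inl b c) (join-inr a _)))
      (⊆ᴿ-trans (join-inr b c) (join-inr a _)))
    (join-lub (join-trans _ c)
      (⊆ᴿ-trans (join-inl a b) (join-inl _ c))
      (join-lub (join-trans _ c) (⊆ᴿ-trans (join-inr a b) (join-inl _ c)) (join-inr _ c)))

  join-cong : ∀ {p p′ q q′ : Rel n} → p ≐ p′ → q ≐ q′ → join p q ≐ join p′ q′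
  join-cong {p} {p′} {q} {q′} p≐p′ q≐q′ = ⊆ᴿ-antisym
    (join-lub (join-trans p′ q′) (λ i j e → join-inl p′ q′ i j (trans (sym (p≐p′ i j)) e))
                                 (λ i j e → join-inr p′ q′ i j (trans (sym (q≐q′ i j)) e)))
    (join-lub (join-trans p q) (λ i j e → join-inl p q i j (trans (p≐p′ i j) e))
                               (λ i j e → join-inr p q i j (trans (q≐q′ i j) e)))

  join-isPartition : ∀ {U : Subset n} {p q} → IsPartition U p → IsPartition U q → IsPartition U (join p q)
  join-isPartition {U} {p} {q} pp pq = record
    { support = join-least p q (λ i j → (U ! i ≡ true) × (U ! j ≡ true)) (λ _ _ _ (ui , _) (_ , uk) → ui , uk)
                  (IsPartition.support pp) (IsPartition.support pq)
    ; refl′   = λ i ui → join-inl p q i i (IsPartition.refl′ pp i ui)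
    ; sym′    = join-least p q (λ i j → join p q j i ≡ true) (λ i j k ji kj → join-trans p q k j i kj ji)
                  (λ i j e → join-inl p q j i (IsPartition.sym′ pp i j e))
                  (λ i j e → join-inr p q j i (IsPartition.sym′ pq i j e))
    ; trans′  = join-trans p q
    }

-- Block counts

first : ∀ {n} → (Fin n → Bool) → Maybe (Fin n)
first {zero}  f = nothing
first {suc n} f = if f zero then just zero else Maybe.map suc (first (f ∘ suc))

Least : ∀ {n} → (Fin n → Bool) → Fin n → Set
Least f k = f k ≡ true × (∀ j → toℕ j < toℕ k → f j ≡ false)

first-just : ∀ {n} (f : Fin n → Bool) {k} → first f ≡ just k → Least f k
first-just {suc n} f e with f zero in f0
first-just {suc n} f refl | true = f0 , λ _ ()
first-just {suc n} f e    | false with first (f ∘ suc) in e′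
first-just {suc n} f refl | false | just k =
  let fk , minimal = first-just (f ∘ suc) e′ in
  fk , λ { zero _ → f0 ; (suc j) (s≤s j<k) → minimal j j<k }

first-nothing : ∀ {n} (f : Fin n → Bool) → first f ≡ nothing → ∀ j → f j ≡ false
first-nothing {suc n} f e j with f zero in f0
first-nothing {suc n} f () j | true
... | false with first (f ∘ suc) in e′
first-nothing {suc n} f refl zero    | false | nothing = f0
first-nothing {suc n} f refl (suc j) | false | nothing = first-nothing (f ∘ suc) e′ j

leastᵇ : ∀ {n} → (Fin n → Bool) → Fin n → Fin n
leastᵇ f default = fromMaybe default (first f)

leastᵇ-least : ∀ {n} (f : Fin n → Bool) default {j} → f j ≡ true → Least f (leastᵇ f default)
leastᵇ-least f default {j} fj with first f in e
... | just k  = first-just f e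
... | nothing = ⊥-elim (true≢false (trans (sym fj) (first-nothing f e j)))

module _ {n : ℕ} where

  _⊆ᵇ_ : Subset n → Subset n → Set
  W ⊆ᵇ U = ∀ i → W ! i ≡ true → U ! i ≡ true

  isLeast⁻ : ∀ (p : Rel n) i → isLeast p i ≡ true → Least (λ j → p j i) i
  isLeast⁻ p i e with ∧-true⁻ (p i i) e
  ... | pii , none-below = pii , λ j j<i → ¬-not λ pji →
    true≢false (trans (sym none-below) (cong not (anyFin-true⁺ _ j (∧-true⁺ (T⇒true (<⇒<ᵇ j<i)) pji))))

  isLeast⁺ : ∀ (p : Rel n) i → Least (λ j → p j i) i → isLeast p i ≡ true
  isLeast⁺ p i (pii , minimal) = ∧-true⁺ pii (cong not (¬-not none-below))
    where
    none-below : any (λ j → (toℕ j <ᵇ toℕ i) ∧ p j i) (allFin n) ≢ true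
    none-below e = let j , e′ = anyFin-true⁻ _ e ; j<i , pji = ∧-true⁻ (toℕ j <ᵇ toℕ i) e′ in
      true≢false (trans (sym pji) (minimal j (<ᵇ⇒< (toℕ j) (toℕ i) (true⇒T j<i))))

  ¬isLeast⁻ : ∀ (p : Rel n) i → p i i ≡ true → isLeast p i ≡ false → ∃ λ j → toℕ j < toℕ i × p j i ≡ true
  ¬isLeast⁻ p i pii ¬least with any (λ j → (toℕ j <ᵇ toℕ i) ∧ p j i) (allFin n) in e
  ... | true  = let j , e′ = anyFin-true⁻ _ e ; j<i , pji = ∧-true⁻ (toℕ j <ᵇ toℕ i) e′ in
                j , <ᵇ⇒< (toℕ j) (toℕ i) (true⇒T j<i) , pji
  ... | false rewrite pii with () ← ¬least

  isLeast-cong : ∀ {p q : Rel n} i → (∀ j → p j i ≡ q j i) → isLeast p i ≡ isLeast q i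
  isLeast-cong {p} {q} i p≐q = bool-ext
    (λ e → let pii , minimal = isLeast⁻ p i e in
           isLeast⁺ q i (trans (sym (p≐q i)) pii , λ j j<i → trans (sym (p≐q j)) (minimal j j<i)))
    (λ e → let qii , minimal = isLeast⁻ q i e in
           isLeast⁺ p i (trans (p≐q i) qii , λ j j<i → trans (p≐q j) (minimal j j<i)))

  nblocks-cong : ∀ {p q : Rel n} → p ≐ q → nblocks p ≡ nblocks q
  nblocks-cong {p} {q} p≐q = countᵇ-cong (isLeast p) (isLeast q) (allFin n) (λ i → isLeast-cong {p} {q} i (λ j → p≐q j i))

  module _ {U : Subset n} {p : Rel n} (pp : IsPartition U p) where
    open IsPartition pp

    isLeast-support : ∀ i → isLeast p i ≡ true → U ! i ≡ true
    isLeast-support i e = proj₁ (support i i (proj₁ (isLeast⁻ p i e)))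

    isLeast-≤ : ∀ i k → isLeast p i ≡ true → p i k ≡ true → toℕ i ≤ toℕ k
    isLeast-≤ i k e pik = ≮⇒≥ λ k<i → true≢false (trans (sym (sym′ i k pik)) (proj₂ (isLeast⁻ p i e) k k<i))

    isLeast-unique : ∀ i i′ → isLeast p i ≡ true → isLeast p i′ ≡ true → p i i′ ≡ true → i ≡ i′
    isLeast-unique i i′ e e′ pii′ = toℕ-injective (≤-antisym (isLeast-≤ i i′ e pii′) (isLeast-≤ i′ i e′ (sym′ i i′ pii′)))

    nblocks-≤-card : nblocks p ≤ card U
    nblocks-≤-card = countᵇ-mono (isLeast p) (U !_) (allFin n) (λ {i} _ → isLeast-support i)

∪-lookup : ∀ {n} (V V′ : Subset n) i → (V ∪ V′) ! i ≡ V ! i ∨ V′ ! i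
∪-lookup V V′ i = lookup-zipWith _∨_ i V V′

─-lookup : ∀ {n} (V X : Subset n) i → (V ─ X) ! i ≡ V ! i ∧ not (X ! i)
─-lookup (v ∷ V) (true  ∷ X) zero    = sym (∧-zeroʳ v)
─-lookup (v ∷ V) (false ∷ X) zero    = sym (∧-identityʳ v)
─-lookup (v ∷ V) (x     ∷ X) (suc i) = ─-lookup V X i

module _ {n : ℕ} where

  ==ᶠ-refl : ∀ (i : Fin n) → (i ==ᶠ i) ≡ true
  ==ᶠ-refl i = T⇒true (≡⇒≡ᵇ (toℕ i) (toℕ i) refl)

  ==ᶠ⇒≡ : ∀ (i j : Fin n) → (i ==ᶠ j) ≡ true → i ≡ j
  ==ᶠ⇒≡ i j e = toℕ-injective (≡ᵇ⇒≡ (toℕ i) (toℕ j) (true⇒T e))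

  ≢⇒==ᶠ-false : ∀ (i j : Fin n) → i ≢ j → (i ==ᶠ j) ≡ false
  ≢⇒==ᶠ-false i j i≢j = ¬-not (i≢j ∘ ==ᶠ⇒≡ i j)

  module _ (W U : Subset n) (p : Rel n) where

    lift⁻ : ∀ i j → lift W U p i j ≡ true → p i j ≡ true ⊎ (i ≡ j × U ! i ≡ true × W ! i ≡ false)
    lift⁻ i j e with ∨-true⁻ (p i j) e
    ... | inj₁ pij = inj₁ pij
    ... | inj₂ new with ∧-true⁻ (i ==ᶠ j) new
    ...   | i=j , rest with ∧-true⁻ (U ! i) rest
    ...     | ui , ¬wi = inj₂ (==ᶠ⇒≡ i j i=j , ui , not-true⁻ ¬wi)

    lift-⊇ : p ⊆ᴿ lift W U p
    lift-⊇ i j = ∨-true⁺ˡ _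

    lift-diagonal : ∀ i → U ! i ≡ true → W ! i ≡ false → lift W U p i i ≡ true
    lift-diagonal i ui ¬wi = ∨-true⁺ʳ (p i i) (∧-true⁺ (==ᶠ-refl i) (∧-true⁺ ui (cong not ¬wi)))

    lift-isPartition : W ⊆ᵇ U → IsPartition W p → IsPartition U (lift W U p)
    lift-isPartition W⊆U pp = record
      { support = support↑ ; refl′ = refl↑ ; sym′ = sym↑ ; trans′ = trans↑ }
      where
      open IsPartition pp
      support↑ : ∀ i j → lift W U p i j ≡ true → (U ! i ≡ true) × (U ! j ≡ true)
      support↑ i j e with lift⁻ i j e
      ... | inj₁ pij = let wi , wj = support i j pij in W⊆U i wi , W⊆U j wj
      ... | inj₂ (refl , ui , _) = ui , ui
      refl↑ : ∀ i → U ! i ≡ true → lift W U p i i ≡ true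
      refl↑ i ui with true-or-false (W ! i)
      ... | inj₁ wi = lift-⊇ i i (refl′ i wi)
      ... | inj₂ ¬wi = lift-diagonal i ui ¬wi
      sym↑ : ∀ i j → lift W U p i j ≡ true → lift W U p j i ≡ true
      sym↑ i j e with lift⁻ i j e
      ... | inj₁ pij = lift-⊇ j i (sym′ i j pij)
      ... | inj₂ (refl , _) = e
      trans↑ : ∀ i j k → lift W U p i j ≡ true → lift W U p j k ≡ true → lift W U p i k ≡ true
      trans↑ i j k e e′ with lift⁻ i j e | lift⁻ j k e′
      ... | inj₁ pij | inj₁ pjk         = lift-⊇ i k (trans′ i j k pij pjk)
      ... | inj₂ (refl , _) | _         = e′
      ... | inj₁ _ | inj₂ (refl , _)    = e

  module _ (W : Subset n) (s : Rel n) where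

    restrict-⊆ : restrict W s ⊆ᴿ s
    restrict-⊆ i j e = proj₁ (∧-true⁻ (s i j) e)

    restrict⁺ : ∀ i j → s i j ≡ true → W ! i ≡ true → W ! j ≡ true → restrict W s i j ≡ true
    restrict⁺ i j sij wi wj = ∧-true⁺ sij (∧-true⁺ wi wj)

    restrict⁻ : ∀ i j → restrict W s i j ≡ true → s i j ≡ true × W ! i ≡ true × W ! j ≡ true
    restrict⁻ i j e = let sij , w = ∧-true⁻ (s i j) e in sij , ∧-true⁻ (W ! i) w

    restrict-isPartition : ∀ {U} → W ⊆ᵇ U → IsPartition U s → IsPartition W (restrict W s)
    restrict-isPartition W⊆U ps = record
      { support = λ i j e → proj₂ (restrict⁻ i j e)
      ; refl′   = λ i wi → restrict⁺ i i (refl′ i (W⊆U i wi)) wi wi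
      ; sym′    = λ i j e → let sij , wi , wj = restrict⁻ i j e in restrict⁺ j i (sym′ i j sij) wj wi
      ; trans′  = λ i j k e e′ → let sij , wi , _ = restrict⁻ i j e ; sjk , _ , wk = restrict⁻ j k e′ in
                                  restrict⁺ i k (trans′ i j k sij sjk) wi wk
      }
      where open IsPartition ps

  card-─ : ∀ {W U : Subset n} → W ⊆ᵇ U → card U ≡ card W + card (U ─ W)
  card-─ {W} {U} W⊆U =
    trans (countᵇ-cong (U !_) (λ i → W ! i ∨ (U ─ W) ! i) (allFin n) split)
          (countᵇ-∨ (W !_) ((U ─ W) !_) (allFin n) disjoint)
    where
    split : ∀ i → U ! i ≡ W ! i ∨ (U ─ W) ! i
    split i rewrite ─-lookup U W i with W ! i in wi
    ... | true  = W⊆U i wi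
    ... | false = sym (∧-identityʳ (U ! i))
    disjoint : ∀ i → W ! i ≡ true → (U ─ W) ! i ≡ false
    disjoint i wi rewrite ─-lookup U W i | wi = ∧-zeroʳ (U ! i)

  module _ {W U : Subset n} {p : Rel n} (W⊆U : W ⊆ᵇ U) (pp : IsPartition W p) where
    open IsPartition pp

    isLeast-lift-inside : ∀ i → W ! i ≡ true → isLeast (lift W U p) i ≡ isLeast p i
    isLeast-lift-inside i wi = isLeast-cong {p = lift W U p} {q = p} i same-column
      where
      same-column : ∀ j → lift W U p j i ≡ p j i
      same-column j with j ==ᶠ i in j=i
      ... | false = ∨-identityʳ (p j i)
      ... | true rewrite ==ᶠ⇒≡ j i j=i | wi | ∧-zeroʳ (U ! i) = ∨-identityʳ (p i i)

    isLeast-lift-outside : ∀ i → W ! i ≡ false → isLeast (lift W U p) i ≡ U ! i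
    isLeast-lift-outside i ¬wi = bool-ext
      (λ e → singleton-in-U (proj₁ (isLeast⁻ (lift W U p) i e)))
      (λ ui → isLeast⁺ (lift W U p) i (lift-diagonal W U p i ui ¬wi , below-i-unrelated))
      where
      outside : ∀ j → p j i ≡ false
      outside j = ¬-not λ pji → true≢false (trans (sym (proj₂ (support j i pji))) ¬wi)
      singleton-in-U : lift W U p i i ≡ true → U ! i ≡ true
      singleton-in-U e with lift⁻ W U p i i e
      ... | inj₁ pii           = ⊥-elim (true≢false (trans (sym pii) (outside i)))
      ... | inj₂ (_ , ui , _) = ui
      below-i-unrelated : ∀ j → toℕ j < toℕ i → lift W U p j i ≡ false
      below-i-unrelated j j<i
        rewrite outside j | ≢⇒==ᶠ-false j i (λ { refl → <-irrefl refl j<i }) = refl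

    isLeast-lift : ∀ i → isLeast (lift W U p) i ≡ isLeast p i ∨ (U ─ W) ! i
    isLeast-lift i with true-or-false (W ! i)
    ... | inj₁ wi rewrite isLeast-lift-inside i wi | ─-lookup U W i | wi | ∧-zeroʳ (U ! i) =
      sym (∨-identityʳ (isLeast p i))
    ... | inj₂ ¬wi rewrite isLeast-lift-outside i ¬wi | ─-lookup U W i | ¬wi | ∧-identityʳ (U ! i) =
      cong (_∨ U ! i) (sym (¬-not λ e → true≢false (trans (sym (isLeast-support pp i e)) ¬wi)))

    nblocks-lift : nblocks (lift W U p) ≡ nblocks p + card (U ─ W)
    nblocks-lift =
      trans (countᵇ-cong (isLeast (lift W U p)) _ (allFin n) isLeast-lift)
            (countᵇ-∨ (isLeast p) ((U ─ W) !_) (allFin n) disjoint)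
      where
      disjoint : ∀ i → isLeast p i ≡ true → (U ─ W) ! i ≡ false
      disjoint i e rewrite ─-lookup U W i | isLeast-support pp i e = ∧-zeroʳ (U ! i)

  EveryBlockMeets : Subset n → Subset n → Rel n → Set
  EveryBlockMeets W U s = ∀ i → U ! i ≡ true → ∃ λ k → s i k ≡ true × W ! k ≡ true

  module _ {W U : Subset n} {s : Rel n} (W⊆U : W ⊆ᵇ U) (ps : IsPartition U s)
           (meets : EveryBlockMeets W U s) where
    open IsPartition ps

    private
      s↓ = restrict W s
      ps↓ = restrict-isPartition W s W⊆U ps

      φ : Fin n → Fin n
      φ i = leastᵇ (λ k → s k i ∧ W ! k) i

      φ-least : ∀ i → U ! i ≡ true → Least (λ k → s k i ∧ W ! k) (φ i)
      φ-least i ui = let k , sik , wk = meets i ui in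
        leastᵇ-least (λ k → s k i ∧ W ! k) i (∧-true⁺ (sym′ i k sik) wk)

      ψ : Fin n → Fin n
      ψ k = leastᵇ (λ m → s m k) k

      ψ-least : ∀ k → U ! k ≡ true → Least (λ m → s m k) (ψ k)
      ψ-least k uk = leastᵇ-least (λ m → s m k) k (refl′ k uk)

      nblocks-≤ : nblocks s ≤ nblocks s↓
      nblocks-≤ = countᵇ-injection (isLeast s) (isLeast s↓) φ (allFin n) (allFin⁺ n)
        (λ {i} _ e → ∈-allFin (φ i) , φ-isLeast i (isLeast-support ps i e))
        (λ {i} {i′} _ _ e e′ φi≡φi′ → isLeast-unique ps i i′ e e′
           (trans′ i (φ i′) i′ (subst (λ k → s i k ≡ true) φi≡φi′ (sym′ _ i (φ-in-block i e))) (φ-in-block i′ e′)))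
        where
        φ-in-block : ∀ i → isLeast s i ≡ true → s (φ i) i ≡ true
        φ-in-block i e = proj₁ (∧-true⁻ (s (φ i) i) (proj₁ (φ-least i (isLeast-support ps i e))))
        φ-isLeast : ∀ i → U ! i ≡ true → isLeast s↓ (φ i) ≡ true
        φ-isLeast i ui with φ-least i ui
        ... | sφi∧wφ , minimal = let sφi , wφ = ∧-true⁻ (s (φ i) i) sφi∧wφ in
          isLeast⁺ s↓ (φ i) (restrict⁺ W s (φ i) (φ i) (refl′ (φ i) (W⊆U _ wφ)) wφ wφ , λ j j<φ → ¬-not λ e →
            let sjφ , wj , _ = restrict⁻ W s j (φ i) e in
            true≢false (trans (sym (∧-true⁺ (trans′ j (φ i) i sjφ sφi) wj)) (minimal j j<φ)))

      nblocks-≥ : nblocks s↓ ≤ nblocks s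
      nblocks-≥ = countᵇ-injection (isLeast s↓) (isLeast s) ψ (allFin n) (allFin⁺ n)
        (λ {k} _ e → ∈-allFin (ψ k) , ψ-isLeast k (W⊆U k (isLeast-support ps↓ k e)))
        (λ {k} {k′} _ _ e e′ ψk≡ψk′ →
           let wk = isLeast-support ps↓ k e ; wk′ = isLeast-support ps↓ k′ e′ in
           isLeast-unique ps↓ k k′ e e′ (restrict⁺ W s k k′
             (trans′ k (ψ k′) k′ (subst (λ m → s k m ≡ true) ψk≡ψk′ (sym′ _ k (ψ-in-block k wk)))
                     (ψ-in-block k′ wk′)) wk wk′))
        where
        ψ-in-block : ∀ k → W ! k ≡ true → s (ψ k) k ≡ true
        ψ-in-block k wk = proj₁ (ψ-least k (W⊆U k wk))
        ψ-isLeast : ∀ k → U ! k ≡ true → isLeast s (ψ k) ≡ true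
        ψ-isLeast k uk with ψ-least k uk
        ... | sψk , minimal = isLeast⁺ s (ψ k) (refl′ (ψ k) (proj₁ (support _ k sψk)) , λ j j<ψ → ¬-not λ sjψ →
          true≢false (trans (sym (trans′ j (ψ k) k sjψ sψk)) (minimal j j<ψ)))

    nblocks-restrict : nblocks (restrict W s) ≡ nblocks s
    nblocks-restrict = ≤-antisym nblocks-≥ nblocks-≤

-- Subadditivity of the block count

module _ {n : ℕ} {U : Subset n} where

  isolate : Rel n → Fin n → Rel n
  isolate x a i j = x i j ∧ ((i ==ᶠ a) ⇔ᵇ (j ==ᶠ a))

  isolate-⊆ : ∀ x a → isolate x a ⊆ᴿ x
  isolate-⊆ x a i j e = proj₁ (∧-true⁻ (x i j) e)

  isolate⁺ : ∀ x a i j → i ≢ a → j ≢ a → x i j ≡ true → isolate x a i j ≡ true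
  isolate⁺ x a i j i≢a j≢a xij rewrite ≢⇒==ᶠ-false i a i≢a | ≢⇒==ᶠ-false j a j≢a = ∧-true⁺ xij refl

  isolate-isPartition : ∀ {x} a → IsPartition U x → IsPartition U (isolate x a)
  isolate-isPartition {x} a px = record
    { support = λ i j e → support i j (isolate-⊆ x a i j e)
    ; refl′   = λ i ui → ∧-true⁺ (refl′ i ui) (⇔ᵇ-true⁺ (i ==ᶠ a) refl)
    ; sym′    = λ i j e → let xij , same = ∧-true⁻ (x i j) e in
                          ∧-true⁺ (sym′ i j xij) (⇔ᵇ-true⁺ (j ==ᶠ a) (sym (⇔ᵇ-true⁻ (i ==ᶠ a) same)))
    ; trans′  = λ i j k e e′ → let xij , same = ∧-true⁻ (x i j) e ; xjk , same′ = ∧-true⁻ (x j k) e′ in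
                               ∧-true⁺ (trans′ i j k xij xjk)
                                       (⇔ᵇ-true⁺ (i ==ᶠ a) (trans (⇔ᵇ-true⁻ (i ==ᶠ a) same) (⇔ᵇ-true⁻ (j ==ᶠ a) same′)))
    }
    where open IsPartition px

  isolate-isLeast : ∀ {x} a → IsPartition U x → U ! a ≡ true → isLeast x a ≡ false →
                    suc (nblocks x) ≤ nblocks (isolate x a)
  isolate-isLeast {x} a px ua ¬least =
    countᵇ-mono-< (isLeast x) (isLeast (isolate x a)) (allFin n) (λ {i} _ → still-least i)
                  (∈-allFin a) a-least ¬least
    where
    open IsPartition px
    still-least : ∀ i → isLeast x i ≡ true → isLeast (isolate x a) i ≡ true
    still-least i e = let xii , minimal = isLeast⁻ x i e in
      isLeast⁺ (isolate x a) i (∧-true⁺ xii (⇔ᵇ-true⁺ (i ==ᶠ a) refl) ,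
        λ j j<i → ¬-not λ e′ → true≢false (trans (sym (isolate-⊆ x a j i e′)) (minimal j j<i)))
    a-least : isLeast (isolate x a) a ≡ true
    a-least = isLeast⁺ (isolate x a) a (∧-true⁺ (refl′ a ua) (⇔ᵇ-true⁺ (a ==ᶠ a) refl) , below-a)
      where
      below-a : ∀ j → toℕ j < toℕ a → isolate x a j a ≡ false
      below-a j j<a rewrite ≢⇒==ᶠ-false j a (λ { refl → <-irrefl refl j<a }) | ==ᶠ-refl a = ∧-zeroʳ (x j a)

  merge : Rel n → Fin n → Fin n → Rel n
  merge z a m i j = z i j ∨ ((z i a ∧ z m j) ∨ (z i m ∧ z a j))

  merge⁻ : ∀ z a m i j → merge z a m i j ≡ true →
           z i j ≡ true ⊎ (z i a ≡ true × z m j ≡ true) ⊎ (z i m ≡ true × z a j ≡ true)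
  merge⁻ z a m i j e with ∨-true⁻ (z i j) e
  ... | inj₁ zij = inj₁ zij
  ... | inj₂ e′ with ∨-true⁻ (z i a ∧ z m j) e′
  ...   | inj₁ am = inj₂ (inj₁ (∧-true⁻ (z i a) am))
  ...   | inj₂ ma = inj₂ (inj₂ (∧-true⁻ (z i m) ma))

  merge⁺ : ∀ z a m i j → z i j ≡ true → merge z a m i j ≡ true
  merge⁺ z a m i j = ∨-true⁺ˡ _

  merge⁺-am : ∀ z a m i j → z i a ≡ true → z m j ≡ true → merge z a m i j ≡ true
  merge⁺-am z a m i j zia zmj = ∨-true⁺ʳ (z i j) (∨-true⁺ˡ _ (∧-true⁺ zia zmj))

  merge⁺-ma : ∀ z a m i j → z i m ≡ true → z a j ≡ true → merge z a m i j ≡ true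
  merge⁺-ma z a m i j zim zaj = ∨-true⁺ʳ (z i j) (∨-true⁺ʳ (z i a ∧ z m j) (∧-true⁺ zim zaj))

  module _ {z : Rel n} (pz : IsPartition U z) (a m : Fin n) where
    open IsPartition pz

    private
      _⨾_ : ∀ {i j k} → z i j ≡ true → z j k ≡ true → z i k ≡ true
      _⨾_ {i} {j} {k} = trans′ i j k
      ˘ : ∀ {i j} → z i j ≡ true → z j i ≡ true
      ˘ {i} {j} = sym′ i j

    merge-trans : TransitiveRel (merge z a m)
    merge-trans i j k e e′ with merge⁻ z a m i j e | merge⁻ z a m j k e′
    ... | inj₁ zij                | inj₁ zjk                = merge⁺ z a m i k (zij ⨾ zjk)
    ... | inj₁ zij                | inj₂ (inj₁ (zja , zmk)) = merge⁺-am z a m i k (zij ⨾ zja) zmk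
    ... | inj₁ zij                | inj₂ (inj₂ (zjm , zak)) = merge⁺-ma z a m i k (zij ⨾ zjm) zak
    ... | inj₂ (inj₁ (zia , zmj)) | inj₁ zjk                = merge⁺-am z a m i k zia (zmj ⨾ zjk)
    ... | inj₂ (inj₁ (zia , zmj)) | inj₂ (inj₁ (zja , zmk)) = merge⁺ z a m i k (zia ⨾ (˘ (zmj ⨾ zja) ⨾ zmk))
    ... | inj₂ (inj₁ (zia , zmj)) | inj₂ (inj₂ (zjm , zak)) = merge⁺ z a m i k (zia ⨾ zak)
    ... | inj₂ (inj₂ (zim , zaj)) | inj₁ zjk                = merge⁺-ma z a m i k zim (zaj ⨾ zjk)
    ... | inj₂ (inj₂ (zim , zaj)) | inj₂ (inj₁ (zja , zmk)) = merge⁺ z a m i k (zim ⨾ zmk)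
    ... | inj₂ (inj₂ (zim , zaj)) | inj₂ (inj₂ (zjm , zak)) = merge⁺ z a m i k (zim ⨾ (˘ (zaj ⨾ zjm) ⨾ zak))

    -- a block of z₂ that is not a block of z is the union of the blocks of a and m in z
    nblocks-merge : ∀ {z₂} → z ⊆ᴿ z₂ → z₂ ⊆ᴿ merge z a m → nblocks z ≤ suc (nblocks z₂)
    nblocks-merge {z₂} z⊆z₂ z₂⊆merge = countᵇ-≤-suc (isLeast z) (isLeast z₂) (allFin n) (allFin⁺ n) only-one
      where
      Lost : Fin n → Set
      Lost i = ∃ λ j → toℕ j < toℕ i × ((z j a ≡ true × z m i ≡ true) ⊎ (z j m ≡ true × z a i ≡ true))
      lost : ∀ i → isLeast z i ≡ true → isLeast z₂ i ≡ false → Lost i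
      lost i e ¬e₂ with ¬isLeast⁻ z₂ i (z⊆z₂ i i (proj₁ (isLeast⁻ z i e))) ¬e₂
      ... | j , j<i , z₂ji with merge⁻ z a m j i (z₂⊆merge j i z₂ji)
      ...   | inj₁ zji = ⊥-elim (true≢false (trans (sym zji) (proj₂ (isLeast⁻ z i e) j j<i)))
      ...   | inj₂ via = j , j<i , via
      ≤ = isLeast-≤ pz
      only-one : ∀ {i i′} → _ → _ → isLeast z i ≡ true → isLeast z₂ i ≡ false →
                 isLeast z i′ ≡ true → isLeast z₂ i′ ≡ false → i ≡ i′
      only-one {i} {i′} _ _ e ¬e₂ e′ ¬e₂′ with lost i e ¬e₂ | lost i′ e′ ¬e₂′
      ... | _ , _ , inj₁ (_ , zmi) | _ , _ , inj₁ (_ , zmi′) = isLeast-unique pz i i′ e e′ (˘ zmi ⨾ zmi′)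
      ... | _ , _ , inj₂ (_ , zai) | _ , _ , inj₂ (_ , zai′) = isLeast-unique pz i i′ e e′ (˘ zai ⨾ zai′)
      ... | j , j<i , inj₁ (zja , zmi) | j′ , j′<i′ , inj₂ (zj′m , zai′) = ⊥-elim (<-irrefl refl
            (<-trans (≤-<-trans (≤ i j′ e (˘ zmi ⨾ ˘ zj′m)) (<-≤-trans j′<i′ (≤ i′ j e′ (˘ zai′ ⨾ ˘ zja)))) j<i))
      ... | j , j<i , inj₂ (zjm , zai) | j′ , j′<i′ , inj₁ (zj′a , zmi′) = ⊥-elim (<-irrefl refl
            (<-trans (≤-<-trans (≤ i j′ e (˘ zai ⨾ ˘ zj′a)) (<-≤-trans j′<i′ (≤ i′ j e′ (˘ zmi′ ⨾ ˘ zjm)))) j<i))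

  join-discrete : ∀ {x y} → IsPartition U x → IsPartition U y →
                  (∀ a → U ! a ≡ true → isLeast x a ≡ true) → join x y ≐ y
  join-discrete {x} {y} px py discrete = ⊆ᴿ-antisym (join-lub (IsPartition.trans′ py) x⊆y (λ _ _ e → e)) (join-inr x y)
    where
    x⊆y : x ⊆ᴿ y
    x⊆y i j xij = let ui , uj = IsPartition.support px i j xij in
      subst (λ k → y i k ≡ true) (isLeast-unique px i j (discrete i ui) (discrete j uj) xij) (IsPartition.refl′ py i ui)

  -- F bounds the number of elements of U that are not least in their x-block; isolating one of
  -- them adds a block to x and removes at most one block from the join.
  nblocks-subadditive′ : ∀ F {x y} → IsPartition U x → IsPartition U y → card U ≤ nblocks x + F →
                         nblocks x + nblocks y ≤ card U + nblocks (join x y)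
  nblocks-subadditive′ F {x} {y} px py bound with any (λ a → U ! a ∧ not (isLeast x a)) (allFin n) in e
  ... | false = +-mono-≤ (nblocks-≤-card px) (≤-reflexive (nblocks-cong (λ i j → sym (join-discrete px py discrete i j))))
    where
    discrete : ∀ a → U ! a ≡ true → isLeast x a ≡ true
    discrete a ua = ¬-not λ ¬least →
      true≢false (trans (sym (anyFin-true⁺ _ a (∧-true⁺ ua (cong not ¬least)))) e)
  ... | true with anyFin-true⁻ _ e
  ...   | a , e′ with ∧-true⁻ (U ! a) e′
  ...     | ua , ¬least′ with not-true⁻ ¬least′
  ...       | ¬least with ¬isLeast⁻ x a (IsPartition.refl′ px a ua) ¬least
  ...         | m , m<a , xma = step F bound
    where
    open IsPartition
    x′ = isolate x a
    px′ = isolate-isPartition a px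
    more-blocks : suc (nblocks x) ≤ nblocks x′
    more-blocks = isolate-isLeast a px ua ¬least
    z = join x′ y
    pz = join-isPartition px′ py
    m≢a : m ≢ a
    m≢a refl = <-irrefl refl m<a
    x⊆merge : x ⊆ᴿ merge z a m
    x⊆merge i j xij with i ≟ a | j ≟ a
    ... | yes refl | yes refl = merge⁺ z a m a a (refl′ pz a ua)
    ... | yes refl | no j≢a   = merge⁺-am z a m a j (refl′ pz a ua)
                                  (join-inl x′ y m j (isolate⁺ x a m j m≢a j≢a (trans′ px m a j xma xij)))
    ... | no i≢a   | yes refl = merge⁺-ma z a m i a
                                  (join-inl x′ y i m (isolate⁺ x a i m i≢a m≢a (trans′ px i a m xij (sym′ px m a xma))))
                                  (refl′ pz a ua)
    ... | no i≢a   | no j≢a   = merge⁺ z a m i j (join-inl x′ y i j (isolate⁺ x a i j i≢a j≢a xij))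
    fewer-joined : nblocks z ≤ suc (nblocks (join x y))
    fewer-joined = nblocks-merge pz a m
      (join-lub (join-trans x y) (⊆ᴿ-trans (isolate-⊆ x a) (join-inl x y)) (join-inr x y))
      (join-lub (merge-trans pz a m) x⊆merge (λ i j e → merge⁺ z a m i j (join-inr x′ y i j e)))
    step : ∀ F → card U ≤ nblocks x + F → nblocks x + nblocks y ≤ card U + nblocks (join x y)
    step zero bound′ = ⊥-elim (<-irrefl refl (≤-trans more-blocks
                         (≤-trans (nblocks-≤-card px′) (subst (card U ≤_) (+-identityʳ _) bound′))))
    step (suc F) bound′ = +-cancelˡ-≤ 1 _ _ (begin
      suc (nblocks x) + nblocks y       ≤⟨ +-monoˡ-≤ (nblocks y) more-blocks ⟩
      nblocks x′ + nblocks y            ≤⟨ nblocks-subadditive′ F px′ py bound″ ⟩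
      card U + nblocks z                ≤⟨ +-monoʳ-≤ (card U) fewer-joined ⟩
      card U + suc (nblocks (join x y)) ≡⟨ +-suc (card U) _ ⟩
      suc (card U + nblocks (join x y)) ∎)
      where
      open ≤-Reasoning
      bound″ : card U ≤ nblocks x′ + F
      bound″ = ≤-trans bound′ (≤-trans (≤-reflexive (+-suc (nblocks x) F)) (+-monoˡ-≤ F more-blocks))

  nblocks-subadditive : ∀ {x y} → IsPartition U x → IsPartition U y →
                        nblocks x + nblocks y ≤ card U + nblocks (join x y)
  nblocks-subadditive {x} px py = nblocks-subadditive′ (card U) px py (m≤n+m (card U) (nblocks x))

+-tight : ∀ {a b c d} → a ≤ b → c ≤ d → a + c ≡ b + d → a ≡ b × c ≡ d
+-tight {a} {b} {c} {d} a≤b c≤d eq =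
  ≤-antisym a≤b (+-cancelʳ-≤ c b a (≤-trans (+-monoʳ-≤ b c≤d) (≤-reflexive (sym eq)))) ,
  ≤-antisym c≤d (+-cancelˡ-≤ a d c (≤-trans (+-monoˡ-≤ d a≤b) (≤-reflexive (sym eq))))

+-tight⇔ : ∀ {a b c d k x y} → a ≤ b → c ≤ d → a + c ≡ x + k → b + d ≡ y + k →
           (a ≡ b × c ≡ d) ⇔ (x ≡ y)
+-tight⇔ {k = k} a≤b c≤d ac≡ bd≡ = mk⇔
  (λ (a≡b , c≡d) → +-cancelʳ-≡ k _ _ (trans (sym ac≡) (trans (cong₂ _+_ a≡b c≡d) bd≡)))
  (λ x≡y → +-tight a≤b c≤d (trans ac≡ (trans (cong (_+ k) x≡y) (sym bd≡))))

rearrange₁ : ∀ a b c ab → (a + b) + (ab + c) ≡ (a + b + c) + ab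
rearrange₁ = solve-∀

rearrange₂ : ∀ N ab abc → (N + ab) + (N + abc) ≡ (N + N + abc) + ab
rearrange₂ = solve-∀

rearrange₃ : ∀ a b c bc → (b + c) + (a + bc) ≡ (a + b + c) + bc
rearrange₃ = solve-∀

≡ᵇ-true⁻ : ∀ {a b} → (a ≡ᵇ b) ≡ true → a ≡ b
≡ᵇ-true⁻ {a} {b} e = ≡ᵇ⇒≡ a b (true⇒T e)

≡ᵇ-true⁺ : ∀ {a b} → a ≡ b → (a ≡ᵇ b) ≡ true
≡ᵇ-true⁺ {a} {b} e = T⇒true (≡⇒≡ᵇ a b e)

module _ {n : ℕ} (U : Subset n) where

  acyclic-sym : ∀ (p q : Rel n) → acyclicᵇ U p q ≡ acyclicᵇ U q p
  acyclic-sym p q = cong₂ _≡ᵇ_ (cong (card U +_) (nblocks-cong (join-comm p q))) (+-comm (nblocks p) (nblocks q))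

  acyclic-congˡ : ∀ {p p′ : Rel n} q → p ≐ p′ → acyclicᵇ U p q ≡ acyclicᵇ U p′ q
  acyclic-congˡ q p≐p′ = cong₂ _≡ᵇ_ (cong (card U +_) (nblocks-cong (join-cong p≐p′ (λ _ _ → refl))))
                                   (cong (_+ nblocks q) (nblocks-cong p≐p′))

  module _ {a b c : Rel n} (pa : IsPartition U a) (pb : IsPartition U b) (pc : IsPartition U c) where

    private
      N = card U
      #a = nblocks a
      #b = nblocks b
      #c = nblocks c

      tight⇔ : ∀ {p q} → acyclicᵇ U p q ≡ true ⇔ nblocks p + nblocks q ≡ N + nblocks (join p q)
      tight⇔ = mk⇔ (sym ∘ ≡ᵇ-true⁻) (≡ᵇ-true⁺ ∘ sym)

      _×-⇔_ : ∀ {P P′ Q Q′ : Set} → P ⇔ P′ → Q ⇔ Q′ → (P × Q) ⇔ (P′ × Q′)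
      f ×-⇔ g = mk⇔ (λ (p , q) → Equivalence.to f p , Equivalence.to g q)
                    (λ (p , q) → Equivalence.from f p , Equivalence.from g q)

      left : (acyclicᵇ U a b ≡ true × acyclicᵇ U (join a b) c ≡ true) ⇔
             (#a + #b + #c ≡ N + N + nblocks (join (join a b) c))
      left = ⇔.trans (tight⇔ ×-⇔ tight⇔)
        (+-tight⇔ (nblocks-subadditive pa pb) (nblocks-subadditive (join-isPartition pa pb) pc)
                  (rearrange₁ #a #b #c _) (rearrange₂ N _ _))
      right : (acyclicᵇ U b c ≡ true × acyclicᵇ U a (join b c) ≡ true) ⇔
              (#a + #b + #c ≡ N + N + nblocks (join a (join b c)))
      right = ⇔.trans (tight⇔ ×-⇔ tight⇔)
        (+-tight⇔ (nblocks-subadditive pb pc) (nblocks-subadditive pa (join-isPartition pb pc))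
                  (rearrange₃ #a #b #c _) (rearrange₂ N _ _))

    acyclic-assoc : (acyclicᵇ U a b ≡ true × acyclicᵇ U (join a b) c ≡ true) ⇔
                    (acyclicᵇ U b c ≡ true × acyclicᵇ U a (join b c) ≡ true)
    acyclic-assoc = ⇔.trans left (⇔.trans (mk⇔ (λ e → trans e abc≡) (λ e → trans e (sym abc≡))) (⇔.sym right))
      where
      abc≡ : N + N + nblocks (join (join a b) c) ≡ N + N + nblocks (join a (join b c))
      abc≡ = cong (N + N +_) (nblocks-cong (join-assoc a b c))

module _ {n : ℕ} (V : Subset n) where

  isTop⁻ : ∀ {r : Rel n} → isTop V r ≡ true → ∀ i j → r i j ≡ V ! i ∧ V ! j
  isTop⁻ e i j = ⇔ᵇ-true⁻ _ (allFin-true⁻ _ (allFin-true⁻ _ e i) j)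

  isTop⁺ : ∀ {r : Rel n} → (∀ i j → r i j ≡ V ! i ∧ V ! j) → isTop V r ≡ true
  isTop⁺ h = allFin-true⁺ _ λ i → allFin-true⁺ _ λ j → ⇔ᵇ-true⁺ _ (h i j)

  isTop-related : ∀ {r : Rel n} → isTop V r ≡ true → ∀ i j → V ! i ≡ true → V ! j ≡ true → r i j ≡ true
  isTop-related {r} e i j vi vj = trans (isTop⁻ {r} e i j) (∧-true⁺ vi vj)

  isTop-partition⁺ : ∀ {r : Rel n} → IsPartition V r → (∀ i j → V ! i ≡ true → V ! j ≡ true → r i j ≡ true) →
                     isTop V r ≡ true
  isTop-partition⁺ {r} pr h = isTop⁺ λ i j → bool-ext
    (λ rij → let vi , vj = IsPartition.support pr i j rij in ∧-true⁺ vi vj)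
    (λ vij → let vi , vj = ∧-true⁻ (V ! i) vij in h i j vi vj)

  isTop-cong : ∀ {r r′ : Rel n} → r ≐ r′ → isTop V r ≡ isTop V r′
  isTop-cong {r} {r′} r≐r′ = bool-ext (λ e → isTop⁺ λ i j → trans (sym (r≐r′ i j)) (isTop⁻ {r} e i j))
                                      (λ e → isTop⁺ λ i j → trans (r≐r′ i j) (isTop⁻ {r′} e i j))

  Feasible : Rel n → Rel n → Bool
  Feasible q p = isTop V (join p q) ∧ acyclicᵇ V p q

  Feasible-sym : ∀ p q → Feasible q p ≡ Feasible p q
  Feasible-sym p q = cong₂ _∧_ (isTop-cong (join-comm p q)) (acyclic-sym V p q)

  Feasible-cong : ∀ q {p p′} → p ≐ p′ → Feasible q p ≡ Feasible q p′
  Feasible-cong q p≐p′ = cong₂ _∧_ (isTop-cong (join-cong p≐p′ (λ _ _ → refl))) (acyclic-congˡ V q p≐p′)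

-- Restriction to a subset meeting every block

≡ᵇ-+-cancelʳ : ∀ a b c → ((a + c) ≡ᵇ (b + c)) ≡ (a ≡ᵇ b)
≡ᵇ-+-cancelʳ a b c = bool-ext (λ e → ≡ᵇ-true⁺ (+-cancelʳ-≡ c a b (≡ᵇ-true⁻ e)))
                              (λ e → ≡ᵇ-true⁺ {a + c} {b + c} (cong (_+ c) (≡ᵇ-true⁻ e)))

+-swap-last : ∀ a b c → a + b + c ≡ a + c + b
+-swap-last = solve-∀

module RestrictedJoin {n : ℕ} {W U : Subset n} (W⊆U : W ⊆ᵇ U) {s : Rel n} (ps : IsPartition U s)
                      (meets : EveryBlockMeets W U s) {p : Rel n} (pp : IsPartition W p) where

  private
    p↑ = lift W U p
    s↓ = restrict W s
    J  = join p↑ s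
    J↓ = join p s↓
    pp↑ = lift-isPartition W U p W⊆U pp
    ps↓ = restrict-isPartition W s W⊆U ps
    pJ  = join-isPartition pp↑ ps
    pJ↓ = join-isPartition pp ps↓
    open IsPartition

    -- J relates i and j exactly when some W-elements in the s-blocks of i and j are J↓-related
    Through : Fin n → Fin n → Set
    Through i j = ∃₂ λ k l → s i k ≡ true × W ! k ≡ true × J↓ k l ≡ true × s l j ≡ true

    through-trans : Transitive Through
    through-trans i j m (k , l , sik , wk , J↓kl , slj) (k′ , l′ , sjk′ , wk′ , J↓k′l′ , sl′m) =
      k , l′ , sik , wk , trans′ pJ↓ k l l′ J↓kl (trans′ pJ↓ l k′ l′ J↓lk′ J↓k′l′) , sl′m
      where
      J↓lk′ : J↓ l k′ ≡ true
      J↓lk′ = join-inr p s↓ l k′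
        (restrict⁺ W s l k′ (trans′ ps l j k′ slj sjk′) (proj₂ (support pJ↓ k l J↓kl)) wk′)

    s⊆through : ∀ i j → s i j ≡ true → Through i j
    s⊆through i j sij = let k , sik , wk = meets i (proj₁ (support ps i j sij)) in
      k , k , sik , wk , refl′ pJ↓ k wk , trans′ ps k i j (sym′ ps i k sik) sij

    p↑⊆through : ∀ i j → p↑ i j ≡ true → Through i j
    p↑⊆through i j e with lift⁻ W U p i j e
    ... | inj₁ pij = let wi , wj = support pp i j pij in
      i , j , refl′ ps i (W⊆U i wi) , wi , join-inl p s↓ i j pij , refl′ ps j (W⊆U j wj)
    ... | inj₂ (refl , ui , _) = let k , sik , wk = meets i ui in
      k , k , sik , wk , refl′ pJ↓ k wk , sym′ ps i k sik

    J-meets : EveryBlockMeets W U J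
    J-meets i ui = let k , sik , wk = meets i ui in k , join-inr p↑ s i k sik , wk

  restrict-join-lift : restrict W J ≐ J↓
  restrict-join-lift = ⊆ᴿ-antisym restrict⊆J↓ J↓⊆restrict
    where
    restrict⊆J↓ : restrict W J ⊆ᴿ J↓
    restrict⊆J↓ i j e with restrict⁻ W J i j e
    ... | Jij , wi , wj with join-least p↑ s Through through-trans p↑⊆through s⊆through i j Jij
    ...   | k , l , sik , wk , J↓kl , slj =
      trans′ pJ↓ i k j (join-inr p s↓ i k (restrict⁺ W s i k sik wi wk))
        (trans′ pJ↓ k l j J↓kl (join-inr p s↓ l j (restrict⁺ W s l j slj (proj₂ (support pJ↓ k l J↓kl)) wj)))
    J↓⊆restrict : J↓ ⊆ᴿ restrict W J
    J↓⊆restrict = join-lub (trans′ (restrict-isPartition W J W⊆U pJ))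
      (λ i j pij → let wi , wj = support pp i j pij in
                   restrict⁺ W J i j (join-inl p↑ s i j (lift-⊇ W U p i j pij)) wi wj)
      (λ i j e → let sij , wi , wj = restrict⁻ W s i j e in restrict⁺ W J i j (join-inr p↑ s i j sij) wi wj)

  isTop-join-lift : isTop U J ≡ isTop W J↓
  isTop-join-lift = bool-ext
    (λ top → isTop-partition⁺ W pJ↓ λ i j wi wj →
       trans (sym (restrict-join-lift i j)) (restrict⁺ W J i j (isTop-related U {J} top i j (W⊆U i wi) (W⊆U j wj)) wi wj))
    (λ top → isTop-partition⁺ U pJ λ i j ui uj →
       let k , Jik , wk = J-meets i ui ; l , Jjl , wl = J-meets j uj
           J↓kl = isTop-related W {J↓} top k l wk wl
           Jkl = restrict-⊆ W J k l (trans (restrict-join-lift k l) J↓kl) in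
       trans′ pJ i k j Jik (trans′ pJ k l j Jkl (sym′ pJ j l Jjl)))

  acyclic-lift : acyclicᵇ U p↑ s ≡ acyclicᵇ W p s↓
  acyclic-lift = begin
    (card U + nblocks J) ≡ᵇ (nblocks p↑ + nblocks s)
      ≡⟨ cong₂ _≡ᵇ_ (cong₂ _+_ (card-─ {W = W} {U} W⊆U) nblocks-J) (cong₂ _+_ (nblocks-lift {U = U} W⊆U pp) nblocks-s) ⟩
    (card W + c + nblocks J↓) ≡ᵇ (nblocks p + c + nblocks s↓)
      ≡⟨ cong₂ _≡ᵇ_ (+-swap-last (card W) c _) (+-swap-last (nblocks p) c _) ⟩
    (card W + nblocks J↓ + c) ≡ᵇ (nblocks p + nblocks s↓ + c)
      ≡⟨ ≡ᵇ-+-cancelʳ (card W + nblocks J↓) (nblocks p + nblocks s↓) c ⟩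
    (card W + nblocks J↓) ≡ᵇ (nblocks p + nblocks s↓) ∎
    where
    open ≡-Reasoning
    c = card (U ─ W)
    nblocks-J : nblocks J ≡ nblocks J↓
    nblocks-J = trans (sym (nblocks-restrict {W = W} {U} W⊆U pJ J-meets)) (nblocks-cong restrict-join-lift)
    nblocks-s : nblocks s ≡ nblocks s↓
    nblocks-s = sym (nblocks-restrict {W = W} {U} W⊆U ps meets)

  Feasible-lift : Feasible U s p↑ ≡ Feasible W s↓ p
  Feasible-lift = cong₂ _∧_ isTop-join-lift acyclic-lift

module _ {n : ℕ} where

  Empty : Subset n → Set
  Empty W = ∀ k → W ! k ≡ false

  card-empty : ∀ W → Empty W → card W ≡ 0
  card-empty W W=∅ = countᵇ-false (W !_) (allFin n) W=∅

  nblocks-empty : ∀ {W} {p : Rel n} → Empty W → IsPartition W p → nblocks p ≡ 0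
  nblocks-empty {W} {p} W=∅ pp = countᵇ-false (isLeast p) (allFin n) λ i →
    ¬-not λ e → true≢false (trans (sym (isLeast-support pp i e)) (W=∅ i))

  Feasible-empty : ∀ {W} {p r : Rel n} → Empty W → IsPartition W p → IsPartition W r → Feasible W r p ≡ true
  Feasible-empty {W} {p} {r} W=∅ pp pr = ∧-true⁺
    (isTop-partition⁺ W (join-isPartition pp pr) λ i _ wi _ → ⊥-elim (true≢false (trans (sym wi) (W=∅ i))))
    (≡ᵇ-true⁺ (trans (cong₂ _+_ (card-empty W W=∅) (nblocks-empty W=∅ (join-isPartition pp pr)))
                     (sym (cong₂ _+_ (nblocks-empty W=∅ pp) (nblocks-empty W=∅ pr)))))

  meets-or-avoids : ∀ (W U : Subset n) (s : Rel n) →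
    EveryBlockMeets W U s ⊎ ∃ λ i → U ! i ≡ true × ∀ k → s i k ≡ true → W ! k ≡ false
  meets-or-avoids W U s with all (λ i → not (U ! i) ∨ any (λ k → s i k ∧ W ! k) (allFin n)) (allFin n) in e
  ... | true  = inj₁ λ i ui → let e′ = allFin-true⁻ _ e i in
    let k , skw = anyFin-true⁻ _ (subst (λ b → not b ∨ _ ≡ true) ui e′) in k , ∧-true⁻ (s i k) skw
  ... | false with allFin-false⁻ _ e
  ...   | i , e′ with U ! i in ui
  ...     | true = inj₂ (i , ui , λ k sik → ¬-not λ wk →
              true≢false (trans (sym (anyFin-true⁺ (λ k → s i k ∧ W ! k) k (∧-true⁺ sik wk))) e′))

  Anchored : Subset n → Subset n → Rel n → Set
  Anchored W U s = EveryBlockMeets W U s ⊎ (isTop U s ≡ true × Empty W)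

  module _ {W U : Subset n} (W⊆U : W ⊆ᵇ U) {p s : Rel n} (pp : IsPartition W p) (ps : IsPartition U s) where

    -- an s-block avoiding W is also a block of join (lift W U p) s, so that join is not {U} unless W = ∅
    isTop-join-lift⇒meets : isTop U (join (lift W U p) s) ≡ true → EveryBlockMeets W U s ⊎ Empty W
    isTop-join-lift⇒meets top with meets-or-avoids W U s
    ... | inj₁ meets = inj₁ meets
    ... | inj₂ (i , ui , avoids) = inj₂ λ k → ¬-not λ wk →
      true≢false (trans (sym wk) (avoids k (subst (_≡ true) (same-block k (isTop-related U {join (lift W U p) s} top i k ui (W⊆U k wk)))
                                                 (IsPartition.refl′ ps i ui))))
      where
      SameBlock : Fin n → Fin n → Set
      SameBlock x y = s i x ≡ s i y
      outside : ∀ x → W ! x ≡ true → s i x ≡ false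
      outside x wx = ¬-not λ six → true≢false (trans (sym wx) (avoids x six))
      same-block : ∀ k → join (lift W U p) s i k ≡ true → SameBlock i k
      same-block = join-least (lift W U p) s SameBlock (λ _ _ _ → trans)
        (λ x y e → case-lift x y (lift⁻ W U p x y e))
        (λ x y sxy → bool-ext (λ six → IsPartition.trans′ ps i x y six sxy)
                              (λ siy → IsPartition.trans′ ps i y x siy (IsPartition.sym′ ps x y sxy)))
        i
        where
        case-lift : ∀ x y → p x y ≡ true ⊎ (x ≡ y × _) → SameBlock x y
        case-lift x y (inj₁ pxy) = let wx , wy = IsPartition.support pp x y pxy in trans (outside x wx) (sym (outside y wy))
        case-lift x y (inj₂ (refl , _)) = refl

    private
      p↑ = lift W U p

      join-lift-empty : Empty W → join p↑ s ≐ s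
      join-lift-empty W=∅ = ⊆ᴿ-antisym (join-lub (IsPartition.trans′ ps) p↑⊆s (λ _ _ e → e)) (join-inr p↑ s)
        where
        p↑⊆s : p↑ ⊆ᴿ s
        p↑⊆s i j e with lift⁻ W U p i j e
        ... | inj₁ pij = ⊥-elim (true≢false (trans (sym (proj₁ (IsPartition.support pp i j pij))) (W=∅ i)))
        ... | inj₂ (refl , ui , _) = IsPartition.refl′ ps i ui

      acyclic-lift-empty : Empty W → acyclicᵇ U p↑ s ≡ true
      acyclic-lift-empty W=∅ = ≡ᵇ-true⁺ (cong₂ _+_ card-U (nblocks-cong (join-lift-empty W=∅)))
        where
        card-U : card U ≡ nblocks p↑
        card-U = begin
          card U                           ≡⟨ card-─ {W = W} {U} W⊆U ⟩
          card W + card (U ─ W)            ≡⟨ cong (_+ card (U ─ W)) (card-empty W W=∅) ⟩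
          card (U ─ W)                     ≡⟨ cong (_+ card (U ─ W)) (nblocks-empty W=∅ pp) ⟨
          nblocks p + card (U ─ W)         ≡⟨ nblocks-lift {U = U} W⊆U pp ⟨
          nblocks p↑                       ∎
          where open ≡-Reasoning

    Feasible-lift⇔ : Feasible U s p↑ ≡ true ⇔ (Anchored W U s × Feasible W (restrict W s) p ≡ true)
    Feasible-lift⇔ = mk⇔ to from
      where
      to : Feasible U s p↑ ≡ true → Anchored W U s × Feasible W (restrict W s) p ≡ true
      to feasible with isTop-join-lift⇒meets (proj₁ (∧-true⁻ _ feasible))
      ... | inj₁ meets = inj₁ meets , trans (sym (RestrictedJoin.Feasible-lift W⊆U ps meets pp)) feasible
      ... | inj₂ W=∅   = inj₂ (trans (sym (isTop-cong U (join-lift-empty W=∅))) (proj₁ (∧-true⁻ _ feasible)) , W=∅) ,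
                         Feasible-empty W=∅ pp (restrict-isPartition W s W⊆U ps)
      from : Anchored W U s × Feasible W (restrict W s) p ≡ true → Feasible U s p↑ ≡ true
      from (inj₁ meets , feasible)   = trans (RestrictedJoin.Feasible-lift W⊆U ps meets pp) feasible
      from (inj₂ (top , W=∅) , _) = ∧-true⁺ (trans (isTop-cong U (join-lift-empty W=∅)) top) (acyclic-lift-empty W=∅)

-- Weighted families of partitions

module _ {n : ℕ} (V : Subset n) (q : Rel n) where

  weights : Family n → List ℕ
  weights A = map proj₂ (filterᵇ (Feasible V q ∘ proj₁) A)

  Heavier : Family n → ℕ → Set
  Heavier A′ w = ∃₂ λ p′ w′ → (p′ , w′) ∈ A′ × Feasible V q p′ ≡ true × w ≤ w′

  Outweighed : Family n → Family n → Set
  Outweighed A A′ = ∀ {p w} → (p , w) ∈ A → Feasible V q p ≡ true → Heavier A′ w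

  ∈-weights⁻ : ∀ A {w} → w ∈ weights A → ∃ λ p → (p , w) ∈ A × Feasible V q p ≡ true
  ∈-weights⁻ A w∈ with ∈-map⁻ proj₂ w∈
  ... | (p , w) , pw∈ , refl = let pw∈A , feasible = ∈-filterᵇ⁻ _ A pw∈ in p , pw∈A , feasible

  ∈-weights⁺ : ∀ A {p w} → (p , w) ∈ A → Feasible V q p ≡ true → w ∈ weights A
  ∈-weights⁺ A pw∈A feasible = ∈-map⁺ proj₂ (∈-filterᵇ⁺ _ A pw∈A feasible)

  Outweighed⇒≼ : ∀ {A A′} → Outweighed A A′ → weights A ≼ weights A′
  Outweighed⇒≼ {A} {A′} outweighed w∈ with ∈-weights⁻ A w∈
  ... | p , pw∈A , feasible with outweighed pw∈A feasible
  ...   | p′ , w′ , pw′∈A′ , feasible′ , w≤w′ = w′ , ∈-weights⁺ A′ pw′∈A′ feasible′ , w≤w′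

  acOpt-≡⇒Outweighed : ∀ {A A′} → acOpt V A q ≡ acOpt V A′ q → Outweighed A A′
  acOpt-≡⇒Outweighed {A} {A′} eq pw∈A feasible with maximum-≡⇒≼ (weights A) (weights A′) eq (∈-weights⁺ A pw∈A feasible)
  ... | w′ , w′∈ , w≤w′ = let p′ , pw′∈A′ , feasible′ = ∈-weights⁻ A′ w′∈ in p′ , w′ , pw′∈A′ , feasible′ , w≤w′

AcRepresents-intro : ∀ {n} (V : Subset n) {A A′ : Family n} →
  (∀ q → IsPartition V q → Outweighed V q A A′ × Outweighed V q A′ A) → AcRepresents V A′ A
AcRepresents-intro V {A} {A′} h q pq = let A≤A′ , A′≤A = h q pq in
  maximum-cong (weights V q A) (weights V q A′) (Outweighed⇒≼ V q A≤A′) (Outweighed⇒≼ V q A′≤A)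

Corresponds : ∀ {n} → Family n → Family n → Set
Corresponds F G = ∀ {p w} → (p , w) ∈ F → ∃ λ p′ → (p′ , w) ∈ G × p ≐ p′

Outweighed-resp : ∀ {n} (V : Subset n) q {F₁ F₂ G₁ G₂} → Corresponds F₂ F₁ → Corresponds G₁ G₂ →
                  Outweighed V q F₁ G₁ → Outweighed V q F₂ G₂
Outweighed-resp V q F₂→F₁ G₁→G₂ outweighed pw∈F₂ feasible =
  let p₁ , pw∈F₁ , p≐p₁ = F₂→F₁ pw∈F₂
      p′ , w′ , pw′∈G₁ , feasible′ , w≤w′ = outweighed pw∈F₁ (trans (sym (Feasible-cong V q p≐p₁)) feasible)
      p″ , pw″∈G₂ , p′≐p″ = G₁→G₂ pw′∈G₁
  in p″ , w′ , pw″∈G₂ , trans (sym (Feasible-cong V q p′≐p″)) feasible′ , w≤w′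

++-Outweighed : ∀ {n} (V : Subset n) q {A A′} B → Outweighed V q A A′ → Outweighed V q (A ++ B) (A′ ++ B)
++-Outweighed V q {A} {A′} B outweighed pw∈ feasible with ∈-++⁻ A pw∈
... | inj₁ pw∈A = let p′ , w′ , pw′∈A′ , feasible′ , w≤w′ = outweighed pw∈A feasible in
                  p′ , w′ , ∈-++⁺ˡ pw′∈A′ , feasible′ , w≤w′
... | inj₂ pw∈B = _ , _ , ∈-++⁺ʳ A′ pw∈B , feasible , ≤-refl

∈-if⁺ : ∀ {c} {x : A} → c ≡ true → x ∈ (if c then x ∷ [] else [])
∈-if⁺ refl = here refl

heaviest : ∀ (P : A → Bool) (wt : A → ℕ) xs {x} → x ∈ xs → P x ≡ true →
           ∃ λ y → y ∈ xs × P y ≡ true × wt x ≤ wt y × (∀ {z} → z ∈ xs → P z ≡ true → wt z ≤ wt y)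
heaviest P wt xs {x} x∈ Px with maximum (map wt (filterᵇ P xs)) | maximum-spec (map wt (filterᵇ P xs))
... | nothing | empty eq with () ← subst (wt x ∈_) eq (∈-map⁺ wt (∈-filterᵇ⁺ P xs x∈ Px))
... | just m  | attained m∈ ub with ∈-map⁻ wt m∈
...   | y , y∈ , refl = let y∈xs , Py = ∈-filterᵇ⁻ P xs y∈ in
  y , y∈xs , Py , below x∈ Px , below
  where
  below : ∀ {z} → z ∈ xs → P z ≡ true → wt z ≤ wt y
  below z∈ Pz = ub (∈-map⁺ wt (∈-filterᵇ⁺ P xs z∈ Pz))

module _ {n : ℕ} where

  eqRel-true⁻ : ∀ (p q : Rel n) → eqRel p q ≡ true → p ≐ q
  eqRel-true⁻ p q e i j = ⇔ᵇ-true⁻ (p i j) (allFin-true⁻ _ (allFin-true⁻ _ e i) j)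

  eqRel-true⁺ : ∀ (p q : Rel n) → p ≐ q → eqRel p q ≡ true
  eqRel-true⁺ p q p≐q = allFin-true⁺ _ λ i → allFin-true⁺ _ λ j → ⇔ᵇ-true⁺ (p i j) (p≐q i j)

  private
    dominates : Family n → Rel n × ℕ → Bool
    dominates A (p , w) = all (λ (p′ , w′) → not (eqRel p p′) ∨ (w′ ≤ᵇ w)) A

  rmc-⊆ : ∀ A {pw} → pw ∈ rmc A → pw ∈ A
  rmc-⊆ A pw∈ = proj₁ (∈-filterᵇ⁻ (dominates A) A pw∈)

  rmc-heaviest : ∀ A {p w} → (p , w) ∈ A → ∃₂ λ p″ w″ → (p″ , w″) ∈ rmc A × p ≐ p″ × w ≤ w″
  rmc-heaviest A {p} {w} pw∈A with heaviest (eqRel p ∘ proj₁) proj₂ A pw∈A (eqRel-true⁺ p p λ _ _ → refl)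
  ... | (p″ , w″) , pw″∈A , p≐p″ , w≤w″ , heavier = p″ , w″ , ∈-filterᵇ⁺ (dominates A) A pw″∈A dominant ,
                                                     eqRel-true⁻ p p″ p≐p″ , w≤w″
    where
    dominant : dominates A (p″ , w″) ≡ true
    dominant = all-true⁺ _ A λ {(p′ , w′)} pw′∈A → case-eqRel p′ w′ pw′∈A (eqRel p″ p′) refl
      where
      case-eqRel : ∀ p′ w′ → (p′ , w′) ∈ A → ∀ b → eqRel p″ p′ ≡ b → not b ∨ (w′ ≤ᵇ w″) ≡ true
      case-eqRel p′ w′ pw′∈A false _ = refl
      case-eqRel p′ w′ pw′∈A true  e = T⇒true (≤⇒≤ᵇ (heavier pw′∈A (eqRel-true⁺ p p′ λ i j →
        trans (eqRel-true⁻ p p″ p≐p″ i j) (eqRel-true⁻ p″ p′ e i j))))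

  rmc-Outweighed : ∀ (V : Subset n) q {A A′} → Outweighed V q A A′ → Outweighed V q (rmc A) (rmc A′)
  rmc-Outweighed V q {A} {A′} outweighed pw∈ feasible with outweighed (rmc-⊆ A pw∈) feasible
  ... | p′ , w′ , pw′∈A′ , feasible′ , w≤w′ with rmc-heaviest A′ pw′∈A′
  ...   | p″ , w″ , pw″∈ , p′≐p″ , w′≤w″ =
    p″ , w″ , pw″∈ , trans (sym (Feasible-cong V q p′≐p″)) feasible′ , ≤-trans w≤w′ w′≤w″

module _ {n : ℕ} (V X : Subset n) where

  private
    W = V ─ X

  ─-⊆ᵇ : W ⊆ᵇ V
  ─-⊆ᵇ i e = proj₁ (∧-true⁻ (V ! i) (trans (sym (─-lookup V X i)) e))

  ─-outside : ∀ i → W ! i ≡ true → X ! i ≡ false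
  ─-outside i e = not-true⁻ (proj₂ (∧-true⁻ (V ! i) (trans (sym (─-lookup V X i)) e)))

  ─-inside : ∀ i → V ! i ≡ true → X ! i ≡ false → W ! i ≡ true
  ─-inside i vi ¬xi = trans (─-lookup V X i) (∧-true⁺ vi (cong not ¬xi))

  blocksLeaveX⇔meets : ∀ {p} → IsPartition V p → blocksLeaveX X p ≡ true ⇔ EveryBlockMeets W V p
  blocksLeaveX⇔meets {p} pp = mk⇔ to from
    where
    open IsPartition pp
    to : blocksLeaveX X p ≡ true → EveryBlockMeets W V p
    to leave i vi with allFin-true⁻ _ leave i
    ... | e rewrite refl′ i vi =
      let j , e′ = anyFin-true⁻ _ e ; pij , ¬xj = ∧-true⁻ (p i j) e′ in
      j , pij , ─-inside j (proj₂ (support i j pij)) (not-true⁻ ¬xj)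
    from : EveryBlockMeets W V p → blocksLeaveX X p ≡ true
    from meets = allFin-true⁺ _ λ i → leaves i (true-or-false (p i i))
      where
      leaves : ∀ i → p i i ≡ true ⊎ p i i ≡ false → not (p i i) ∨ any (λ j → p i j ∧ not (X ! j)) (allFin n) ≡ true
      leaves i (inj₂ ¬pii) rewrite ¬pii = refl
      leaves i (inj₁ pii) = let k , pik , wk = meets i (proj₁ (support i i pii)) in
        ∨-true⁺ʳ (not (p i i)) (anyFin-true⁺ _ k (∧-true⁺ pik (cong not (─-outside k wk))))

  ∈-proj⁻ : ∀ A {y} → y ∈ proj V X A →
            ∃₂ λ p w → (p , w) ∈ A × blocksLeaveX X p ≡ true × y ≡ (restrict W p , w)
  ∈-proj⁻ A y∈ with ∈-map⁻ _ y∈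
  ... | (p , w) , pw∈ , refl = let pw∈A , leave = ∈-filterᵇ⁻ _ A pw∈ in p , w , pw∈A , leave , refl

  ∈-proj⁺ : ∀ A {p w} → (p , w) ∈ A → blocksLeaveX X p ≡ true → (restrict W p , w) ∈ proj V X A
  ∈-proj⁺ A pw∈A leave = ∈-map⁺ _ (∈-filterᵇ⁺ (blocksLeaveX X ∘ proj₁) A pw∈A leave)

  module _ {q : Rel n} (pq : IsPartition W q) where

    Feasible-restrict : ∀ {p} → IsPartition V p → EveryBlockMeets W V p →
                        Feasible V (lift W V q) p ≡ Feasible W q (restrict W p)
    Feasible-restrict {p} pp meets = begin
      Feasible V (lift W V q) p  ≡⟨ Feasible-sym V p (lift W V q) ⟩
      Feasible V p (lift W V q)  ≡⟨ RestrictedJoin.Feasible-lift ─-⊆ᵇ pp meets pq ⟩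
      Feasible W (restrict W p) q ≡⟨ Feasible-sym W q (restrict W p) ⟩
      Feasible W q (restrict W p) ∎
      where open ≡-Reasoning

    proj-Outweighed : ∀ {A A′} → AllPartitions V A → AllPartitions V A′ →
                      Outweighed V (lift W V q) A A′ → Outweighed W q (proj V X A) (proj V X A′)
    proj-Outweighed {A} {A′} apA apA′ outweighed y∈ feasible with ∈-proj⁻ A y∈
    ... | p , w , pw∈A , leave , refl with outweighed pw∈A (trans (Feasible-restrict (apA pw∈A) meets) feasible)
      where meets = Equivalence.to (blocksLeaveX⇔meets (apA pw∈A)) leave
    ...   | p′ , w′ , pw′∈A′ , feasible′ , w≤w′ =
      restrict W p′ , w′ , ∈-proj⁺ A′ pw′∈A′ (Equivalence.from (blocksLeaveX⇔meets (apA′ pw′∈A′)) meets′) ,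
      trans (sym (Feasible-restrict (apA′ pw′∈A′) meets′)) feasible′ , w≤w′
      where
      meets = Equivalence.to (blocksLeaveX⇔meets (apA pw∈A)) leave
      top′ : isTop V (join (lift W V q) p′) ≡ true
      top′ = trans (isTop-cong V (join-comm (lift W V q) p′)) (proj₁ (∧-true⁻ _ feasible′))
      meets′ : EveryBlockMeets W V p′
      meets′ with isTop-join-lift⇒meets ─-⊆ᵇ pq (apA′ pw′∈A′) top′
      ... | inj₁ meets′ = meets′
      ... | inj₂ W=∅ = λ i vi → let k , _ , wk = meets i vi in ⊥-elim (true≢false (trans (sym wk) (W=∅ k)))

module _ {n : ℕ} (V V′ : Subset n) where

  private
    U = V ∪ V′

  ∪-⊆ᵇˡ : V ⊆ᵇ U
  ∪-⊆ᵇˡ i vi = trans (∪-lookup V V′ i) (∨-true⁺ˡ _ vi)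

  ∪-⊆ᵇʳ : V′ ⊆ᵇ U
  ∪-⊆ᵇʳ i v′i = trans (∪-lookup V V′ i) (∨-true⁺ʳ (V ! i) v′i)

  data AcJoinMember (A B : Family n) : Rel n × ℕ → Set where
    member : ∀ {p wa b wb} → (p , wa) ∈ A → (b , wb) ∈ B → acyclicᵇ U (lift V U p) (lift V′ U b) ≡ true →
             AcJoinMember A B (join (lift V U p) (lift V′ U b) , wa + wb)

  ∈-acjoin⁻ : ∀ A B {y} → y ∈ acjoin V V′ A B → AcJoinMember A B y
  ∈-acjoin⁻ A B y∈ with find (∈-concatMap⁻ _ {xs = A} y∈)
  ... | (p , wa) , pw∈A , y∈′ with find (∈-concatMap⁻ _ {xs = B} y∈′)
  ...   | (b , wb) , bw∈B , y∈″ with acyclicᵇ U (lift V U p) (lift V′ U b) in acyclic | y∈″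
  ...     | true | here refl = member pw∈A bw∈B acyclic

  ∈-acjoin⁺ : ∀ A B {p wa b wb} → (p , wa) ∈ A → (b , wb) ∈ B → acyclicᵇ U (lift V U p) (lift V′ U b) ≡ true →
              (join (lift V U p) (lift V′ U b) , wa + wb) ∈ acjoin V V′ A B
  ∈-acjoin⁺ A B pw∈A bw∈B acyclic =
    ∈-concatMap⁺ _ (lose pw∈A (∈-concatMap⁺ _ (lose bw∈B (∈-if⁺ acyclic))))

  module AcJoinEntry {b q : Rel n} (pb : IsPartition V′ b) (pq : IsPartition U q) where

    private
      b↑ = lift V′ U b
      pb↑ = lift-isPartition V′ U b ∪-⊆ᵇʳ pb
      s  = join b↑ q
      ps = join-isPartition pb↑ pq

    Compatible : Set
    Compatible = acyclicᵇ U b↑ q ≡ true × Anchored V U s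

    trace-isPartition : IsPartition V (restrict V s)
    trace-isPartition = restrict-isPartition V s ∪-⊆ᵇˡ ps

    entry-Feasible⇔ : ∀ {p} → IsPartition V p →
      (acyclicᵇ U (lift V U p) b↑ ≡ true × Feasible U q (join (lift V U p) b↑) ≡ true) ⇔
      (Compatible × Feasible V (restrict V s) p ≡ true)
    entry-Feasible⇔ {p} pp = mk⇔ to from
      where
      p↑ = lift V U p
      pp↑ = lift-isPartition V U p ∪-⊆ᵇˡ pp
      assoc = acyclic-assoc U pp↑ pb↑ pq
      split = Feasible-lift⇔ ∪-⊆ᵇˡ pp ps
      top-assoc : isTop U (join (join p↑ b↑) q) ≡ isTop U (join p↑ s)
      top-assoc = isTop-cong U (join-assoc p↑ b↑ q)
      to : acyclicᵇ U p↑ b↑ ≡ true × Feasible U q (join p↑ b↑) ≡ true → Compatible × Feasible V (restrict V s) p ≡ true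
      to (acyclic₁ , feasible) =
        let top , acyclic₂ = ∧-true⁻ _ feasible
            acyclic-bq , acyclic-ps = Equivalence.to assoc (acyclic₁ , acyclic₂)
            anchored , feasible-V = Equivalence.to split (∧-true⁺ (trans (sym top-assoc) top) acyclic-ps)
        in (acyclic-bq , anchored) , feasible-V
      from : Compatible × Feasible V (restrict V s) p ≡ true → acyclicᵇ U p↑ b↑ ≡ true × Feasible U q (join p↑ b↑) ≡ true
      from ((acyclic-bq , anchored) , feasible-V) =
        let top , acyclic-ps = ∧-true⁻ _ (Equivalence.from split (anchored , feasible-V))
            acyclic₁ , acyclic₂ = Equivalence.from assoc (acyclic-bq , acyclic-ps)
        in acyclic₁ , ∧-true⁺ (trans top-assoc top) acyclic₂

  acjoin-Outweighed : ∀ {A A′ B q} → AllPartitions V A → AllPartitions V A′ → AllPartitions V′ B →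
    IsPartition U q → (∀ r → IsPartition V r → Outweighed V r A A′) →
    Outweighed U q (acjoin V V′ A B) (acjoin V V′ A′ B)
  acjoin-Outweighed {A} {A′} {B} {q} apA apA′ apB pq outweighed y∈ = outweigh (∈-acjoin⁻ A B y∈)
    where
    outweigh : ∀ {p w} → AcJoinMember A B (p , w) → Feasible U q p ≡ true → Heavier U q (acjoin V V′ A′ B) w
    outweigh (member {wb = wb} pw∈A bw∈B acyclic) feasible =
      let open AcJoinEntry (apB bw∈B) pq
          compatible , feasible-V = Equivalence.to (entry-Feasible⇔ (apA pw∈A)) (acyclic , feasible)
          p′ , wa′ , pw′∈A′ , feasible-V′ , wa≤wa′ = outweighed _ trace-isPartition pw∈A feasible-V
          acyclic′ , feasible′ = Equivalence.from (entry-Feasible⇔ (apA′ pw′∈A′)) (compatible , feasible-V′)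
      in _ , wa′ + wb , ∈-acjoin⁺ A′ B pw′∈A′ bw∈B acyclic′ , feasible′ , +-monoˡ-≤ wb wa≤wa′

acyclic-swap : ∀ {n} (V V′ : Subset n) p b →
  acyclicᵇ (V ∪ V′) (lift V (V ∪ V′) p) (lift V′ (V ∪ V′) b) ≡ true →
  acyclicᵇ (V′ ∪ V) (lift V′ (V′ ∪ V) b) (lift V (V′ ∪ V) p) ≡ true
acyclic-swap V V′ p b acyclic =
  subst (λ W → acyclicᵇ W (lift V′ W b) (lift V W p) ≡ true) (∪-comm V V′)
        (trans (acyclic-sym (V ∪ V′) (lift V′ (V ∪ V′) b) (lift V (V ∪ V′) p)) acyclic)

join-swap : ∀ {n} (V V′ : Subset n) p b →
  join (lift V (V ∪ V′) p) (lift V′ (V ∪ V′) b) ≐ join (lift V′ (V′ ∪ V) b) (lift V (V′ ∪ V) p)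
join-swap V V′ p b =
  subst (λ W → join (lift V (V ∪ V′) p) (lift V′ (V ∪ V′) b) ≐ join (lift V′ W b) (lift V W p)) (∪-comm V V′)
        (join-comm (lift V (V ∪ V′) p) (lift V′ (V ∪ V′) b))

acjoin-swap : ∀ {n} (V V′ : Subset n) A B → Corresponds (acjoin V V′ A B) (acjoin V′ V B A)
acjoin-swap V V′ A B y∈ = swap (∈-acjoin⁻ V V′ A B y∈)
  where
  swap : ∀ {p w} → AcJoinMember V V′ A B (p , w) → ∃ λ p′ → (p′ , w) ∈ acjoin V′ V B A × p ≐ p′
  swap (member {p} {wa} {b} {wb} pw∈A bw∈B acyclic) =
    join (lift V′ (V′ ∪ V) b) (lift V (V′ ∪ V) p) ,
    subst (λ w → (join (lift V′ (V′ ∪ V) b) (lift V (V′ ∪ V) p) , w) ∈ acjoin V′ V B A) (+-comm wb wa)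
          (∈-acjoin⁺ V′ V B A bw∈B pw∈A (acyclic-swap V V′ p b acyclic)) ,
    join-swap V V′ p b

acjoin-Outweighed-swap : ∀ {n} (V V′ : Subset n) {A A′ B q} →
  AllPartitions V A → AllPartitions V A′ → AllPartitions V′ B →
  IsPartition (V′ ∪ V) q → (∀ r → IsPartition V r → Outweighed V r A A′) →
  Outweighed (V′ ∪ V) q (acjoin V′ V B A) (acjoin V′ V B A′)
acjoin-Outweighed-swap V V′ {A} {A′} {B} {q} apA apA′ apB pq outweighed =
  Outweighed-resp (V′ ∪ V) q (acjoin-swap V′ V B A) (acjoin-swap V V′ A′ B)
    (subst (λ U → Outweighed U q (acjoin V V′ A B) (acjoin V V′ A′ B)) (∪-comm V V′)
      (acjoin-Outweighed V V′ apA apA′ apB (subst (λ U → IsPartition U q) (∪-comm V′ V) pq) outweighed))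

lemma3p6 : ∀ {n : ℕ} (V V′ : Subset n) (A A′ : Family n)
    → AllPartitions V A → AllPartitions V A′
    → AcRepresents V A′ A
    → ((B : Family n) → AllPartitions V B → AcRepresents V (A′ ++ B) (A ++ B))
      × AcRepresents V (rmc A′) (rmc A)
      × ((X : Subset n) → X ⊆ V → AcRepresents (V ─ X) (proj V X A′) (proj V X A))
      × ((B : Family n) → AllPartitions V′ B
          → AcRepresents (V ∪ V′) (acjoin V V′ A′ B) (acjoin V V′ A B)
            × AcRepresents (V′ ∪ V) (acjoin V′ V B A′) (acjoin V′ V B A))
lemma3p6 V V′ A A′ apA apA′ represents =
    (λ B _ → AcRepresents-intro V λ q pq → ++-Outweighed V q B (forth q pq) , ++-Outweighed V q B (back q pq))
  , AcRepresents-intro V (λ q pq → rmc-Outweighed V q (forth q pq) , rmc-Outweighed V q (back q pq))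
  , (λ X _ → AcRepresents-intro (V ─ X) λ q pq →
       let pq↑ = lift-isPartition (V ─ X) V q (─-⊆ᵇ V X) pq in
       proj-Outweighed V X pq apA apA′ (forth _ pq↑) , proj-Outweighed V X pq apA′ apA (back _ pq↑))
  , λ B apB →
      AcRepresents-intro (V ∪ V′) (λ q pq →
        acjoin-Outweighed V V′ apA apA′ apB pq forth , acjoin-Outweighed V V′ apA′ apA apB pq back)
    , AcRepresents-intro (V′ ∪ V) (λ q pq →
        acjoin-Outweighed-swap V V′ apA apA′ apB pq forth , acjoin-Outweighed-swap V V′ apA′ apA apB pq back)
  where
  forth : ∀ q → IsPartition V q → Outweighed V q A A′
  forth q pq = acOpt-≡⇒Outweighed V q (represents q pq)
  back : ∀ q → IsPartition V q → Outweighed V q A′ A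
  back q pq = acOpt-≡⇒Outweighed V q (sym (represents q pq))
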